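{- (Collapsing) Let $\Gamma$ be a $\Sigma(\Omega)$-sequent, let $\alpha\in\vartheta(\varepsilon_{\Omega+1})$ and $X\subseteq\vartheta(\varepsilon_{\Omega+1})$ satisfy $\alpha\in\mathcal H_\alpha(X)$ and $X\subseteq\bigcap\{C_\xi(\vartheta\xi)\mid\alpha\prec\xi\}$. If $\mathcal H_\alpha[X]\vdash^\beta_{\Omega+1}\Gamma$, then $\mathcal H_\eta[X]\vdash^{\vartheta\eta}_{\vartheta\eta}\Gamma$ for $\eta=\alpha+\omega(\beta)$.
   Context: Ordinal terms: The set $\vartheta(\varepsilon_{\Omega+1})$ of terms, a relation $\prec$ and finite sets $E(\alpha)$ are defined by simultaneous recursion on term length: Terms: $\Omega$; $\vartheta\alpha$ for each term $\alpha$; $\langle\alpha_0,\dots,\alpha_{n-1}\rangle$ ($n\ge0$) provided that if $n>1$ then $\alpha_{n-1}\preceq\dots\preceq\alpha_0$ ($\preceq$ is $\prec$ or syntactic equality), and if $n=1$ then $\alpha_0$ is not $\Omega$ or of the form $\vartheta\beta$. $E(\Omega)=\emptyset$, $E(\vartheta\alpha)=\{\vartheta\alpha\}$, $E(\langle\alpha_0,\dots\rangle)=\bigcup_iE(\alpha_i)$. $\alpha\prec\beta$ iff: (1) $\alpha=\Omega$, $\beta=\langle\beta_0,\dots,\beta_{n-1}\rangle$, $n>0$, $\Omega\preceq\beta_0$; or (2) $\alpha=\vartheta\alpha'$ and either $\beta=\Omega$, or $\beta=\langle\beta_0,\dots\rangle$ nonempty with $\alpha\preceq\beta_0$, or $\beta=\vartheta\beta'$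 with $\alpha'\prec\beta'$ and $\gamma\prec\beta$ for all $\gamma\in E(\alpha')$, or $\beta=\vartheta\beta'$ with $\alpha\preceq\gamma$ for some $\gamma\in E(\beta')$; or (3) $\alpha=\langle\alpha_0,\dots,\alpha_{m-1}\rangle$ and either $\beta\in\{\Omega\}\cup\{\vartheta\beta'\}$ with ($m=0$ or $\alpha_0\prec\beta$), or $\beta=\langle\beta_0,\dots,\beta_{n-1}\rangle$ is lexicographically larger ($\alpha$ a proper initial segment of $\beta$, or first difference $\alpha_j\prec\beta_j$). Numerals: $n:=\langle0,\dots,0\rangle$ ($n$ entries, $0=\langle\rangle$), $\omega:=\langle 1\rangle$. Addition: identify $\Omega,\vartheta\alpha$ with $\langle\Omega\rangle,\langle\vartheta\alpha\rangle$ and set $\langle\alpha_0,\dots,\alpha_{m-1}\rangle+\langle\beta_0,\dots,\beta_{n-1}\rangle=\langle\alpha_0,\dots,\alpha_{k-1},\beta_0,\dots,\beta_{n-1}\rangle$ where $k$ is largest such that $\beta_0\preceq\alpha_{k-1}$ (all of $\alpha$ if $n=0$; $k=0$ if no such); $\omega\cdot\Omega=\Omega$, $\omega\cdot\vartheta\alpha=\vartheta\alpha$, $\omega\cdot\langle\alpha_0,\dots\rangle=\langle1+\alpha_0,\dots\rangle$; $\omega(\alpha)=\alpha$ if $\alpha$ is $\Omega$ or of the form $\vartheta\alpha'$, and $\omega(\alpha)=\langle\alpha\rangle$ otherwise. Coefficient sets: $C_\alpha(\beta)$ is the least set containing $\Omega$ and all $\gamma\prec\beta$, containing $\vartheta\gamma$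 whenever it contains $\gamma$ with $\gamma\prec\alpha$, and containing every term $\langle\gamma_0,\dots,\gamma_{n-1}\rangle$ whose entries it contains. $\mathcal H_\alpha(Y)=\bigcap\{C_\gamma(\delta)\mid\alpha\prec\gamma,\ Y\subseteq C_\gamma(\delta)\}$ (all terms if there are no such $\gamma,\delta$); $\mathcal H_\alpha[X]$ is the operator $Y\mapsto\mathcal H_\alpha(X\cup Y)$. Language: formulas are in negation normal form. An operator form is a formula $\varphi(x,X)$ of arithmetic with an extra unary predicate $X$, with one free number variable and no subformula $\neg Xt$. $\mathcal L^\Omega_{\mathsf{ID}}$ extends $\mathcal L_{\mathsf{PA}}$ by predicates $I^{\prec\alpha}_\varphi$ for each operator form $\varphi$ and term $\alpha\preceq\Omega$; $\varphi(t,I^{\prec\gamma}_\varphi)$ replaces $x$ by $t$ and $Xs$ by $I^{\prec\gamma}_\varphi s$. A $\Sigma(\Omega)$-formula is one with no subformula of the form $\neg I^{\prec\Omega}_\varphi t$; a $\Sigma(\Omega)$-sequent is a finite set of $\Sigma(\Omega)$-sentences. Each sentence is assigned a disjunction or conjunction: a false $\mathcal L_{\mathsf{PA}}$-literal $\simeq$ empty disjunction; $I^{\prec\alpha}_\varphi t\simeq\bigvee_{\gamma\prec\alpha}\varphi(t,I^{\prec\gamma}_\varphi)$; $\psi_0\lor\psi_1\simeq\bigvee_{i\prec2}\psi_i$; $\exists x\,\psi(x)\simeq\bigvee_{n\prec\omega}\psi(n)$; and $\neg\psi\simeq\bigwedge_{\gamma\prec\alpha}\neg\psi_\gamma$ whenever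 $\psi\simeq\bigvee_{\gamma\prec\alpha}\psi_\gamma$. Ranks: $\operatorname{rk}=0$ for $\mathcal L_{\mathsf{PA}}$-literals, $\operatorname{rk}(\pm I^{\prec\alpha}_\varphi t)=\omega\cdot\alpha$, $\operatorname{rk}(\psi_0\lor\psi_1)=\operatorname{rk}(\psi_0\land\psi_1)=\max(\operatorname{rk}\psi_0,\operatorname{rk}\psi_1)+1$, $\operatorname{rk}(\exists x\psi)=\operatorname{rk}(\forall x\psi)=\operatorname{rk}(\psi)+1$. $k(\psi)$ is the set of $\alpha$ such that $\psi$ contains a literal $I^{\prec\alpha}_\varphi t$ or $\neg I^{\prec\alpha}_\varphi t$; $k(\Gamma)=\bigcup_{\psi\in\Gamma}k(\psi)$. Operators: a nice operator is $\mathcal H$ from subsets of terms to subsets of terms with $X\subseteq\mathcal H(X)$, ($X\subseteq\mathcal H(Y)\Rightarrow\mathcal H(X)\subseteq\mathcal H(Y)$), and ($\alpha\in\mathcal H(X)\Leftrightarrow E(\alpha)\subseteq\mathcal H(X)$); $\mathcal H[Z](X):=\mathcal H(Z\cup X)$. Derivations: $\mathcal H\vdash^\alpha_\rho\Gamma$ is defined by recursion on $\alpha$: it holds iff $\{\alpha\}\cup k(\Gamma)\subseteq\mathcal H(\emptyset)$ and one of: ($\bigwedge$) some $\psi\simeq\bigwedge_{\gamma\prec\delta}\psi_\gamma$ in $\Gamma$ such that for every $\gamma\prec\delta$ there is $\alpha(\gamma)\prec\alpha$ with $\mathcal H[\{\gamma\}]\vdash^{\alpha(\gamma)}_\rho\Gamma\cup\{\psi_\gamma\}$;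 ($\bigvee$) some $\psi\simeq\bigvee_{\gamma\prec\delta}\psi_\gamma$ in $\Gamma$, some $\gamma\prec\delta$ with $\gamma\prec\alpha$ and $\gamma\in\mathcal H(\emptyset)$, and $\alpha'\prec\alpha$ with $\mathcal H\vdash^{\alpha'}_\rho\Gamma\cup\{\psi_\gamma\}$; (Cut) some sentence $\psi$ with $\operatorname{rk}(\psi)\prec\rho$ and $\alpha'\prec\alpha$ with $\mathcal H\vdash^{\alpha'}_\rho\Gamma\cup\{\psi\}$ and $\mathcal H\vdash^{\alpha'}_\rho\Gamma\cup\{\neg\psi\}$; (Fix) $\Omega\preceq\alpha$, some $I^{\prec\Omega}_\varphi t\in\Gamma$ and $\alpha'\prec\alpha$ with $\mathcal H\vdash^{\alpha'}_\rho\Gamma\cup\{\varphi(t,I^{\prec\Omega}_\varphi)\}$. -}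

module Defs where

open import Data.Bool using (Bool; true; false; _∧_; _∨_; not; if_then_else_; T)
open import Data.Nat using (ℕ; _≡ᵇ_) renaming (zero to nz; suc to ns; _+_ to _+ℕ_; _*_ to _*ℕ_)
open import Data.Fin using (Fin) renaming (zero to fz; suc to fs)
open import Data.List using (List; []; _∷_; _++_; map; replicate; length)
open import Data.List.Relation.Unary.All using (All)
open import Data.List.Membership.Propositional using (_∈_)
open import Data.Product using (Σ; _×_; _,_)
open import Data.Sum using (_⊎_)
open import Data.Empty using (⊥)
open import Data.Unit using (⊤)
open import Relation.Binary.PropositionalEquality using (_≡_; _≢_)

-- Raw ordinal terms.  The terms of ϑ(ε_{Ω+1}) are the raw terms
-- satisfying WF (defined below, simultaneously with ≺).

data Tm : Set where
  Ω  : Tm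
  ϑ  : Tm → Tm
  ⟨_⟩ : List Tm → Tm

mutual
  _≡ᵗ_ : Tm → Tm → Bool
  Ω ≡ᵗ Ω = true
  ϑ a ≡ᵗ ϑ b = a ≡ᵗ b
  ⟨ as ⟩ ≡ᵗ ⟨ bs ⟩ = as ≡ˡ bs
  _ ≡ᵗ _ = false

  _≡ˡ_ : List Tm → List Tm → Bool
  [] ≡ˡ [] = true
  (a ∷ as) ≡ˡ (b ∷ bs) = (a ≡ᵗ b) ∧ (as ≡ˡ bs)
  _ ≡ˡ _ = false

mutual
  E : Tm → List Tm
  E Ω = []
  E (ϑ a) = ϑ a ∷ []
  E ⟨ as ⟩ = Es as

  Es : List Tm → List Tm
  Es [] = []
  Es (a ∷ as) = E a ++ Es as

-- The relation ≺ (as a Boolean function, by recursion on term length).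
-- allE< a b  means  "γ ≺ b for all γ ∈ E(a)"  and
-- anyE≥ x b  means  "x ≼ γ for some γ ∈ E(b)"; they are written by
-- structural recursion on a resp. b (unfolding the definition of E) so that
-- Agda sees the recursion on term length.
mutual
  _<ᵇ_ : Tm → Tm → Bool
  Ω <ᵇ Ω = false
  Ω <ᵇ ϑ _ = false
  Ω <ᵇ ⟨ [] ⟩ = false
  Ω <ᵇ ⟨ b ∷ _ ⟩ = Ω ≤ᵇ b
  ϑ a <ᵇ Ω = true
  ϑ a <ᵇ ⟨ [] ⟩ = false
  ϑ a <ᵇ ⟨ b ∷ _ ⟩ = ϑ a ≤ᵇ b
  ϑ a <ᵇ ϑ b = ((a <ᵇ b) ∧ allE< a (ϑ b)) ∨ anyE≥ (ϑ a) b
  ⟨ [] ⟩ <ᵇ Ω = true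
  ⟨ [] ⟩ <ᵇ ϑ _ = true
  ⟨ a ∷ _ ⟩ <ᵇ Ω = a <ᵇ Ω
  ⟨ a ∷ _ ⟩ <ᵇ ϑ b = a <ᵇ ϑ b
  ⟨ as ⟩ <ᵇ ⟨ bs ⟩ = lex as bs

  _≤ᵇ_ : Tm → Tm → Bool
  a ≤ᵇ b = (a <ᵇ b) ∨ (a ≡ᵗ b)

  lex : List Tm → List Tm → Bool
  lex [] [] = false
  lex [] (_ ∷ _) = true
  lex (_ ∷ _) [] = false
  lex (a ∷ as) (b ∷ bs) = (a <ᵇ b) ∨ ((a ≡ᵗ b) ∧ lex as bs)

  allE< : Tm → Tm → Bool
  allE< Ω b = true
  allE< (ϑ a) b = ϑ a <ᵇ b
  allE< ⟨ as ⟩ b = allEs< as b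

  allEs< : List Tm → Tm → Bool
  allEs< [] b = true
  allEs< (a ∷ as) b = allE< a b ∧ allEs< as b

  anyE≥ : Tm → Tm → Bool
  anyE≥ x Ω = false
  anyE≥ x (ϑ b) = x ≤ᵇ ϑ b
  anyE≥ x ⟨ bs ⟩ = anyEs≥ x bs

  anyEs≥ : Tm → List Tm → Bool
  anyEs≥ x [] = false
  anyEs≥ x (b ∷ bs) = anyE≥ x b ∨ anyEs≥ x bs

_≺_ : Tm → Tm → Set
a ≺ b = T (a <ᵇ b)

_≼_ : Tm → Tm → Set
a ≼ b = T (a ≤ᵇ b)

descending : List Tm → Bool
descending [] = true
descending (_ ∷ []) = true
descending (a ∷ b ∷ rest) = (b ≤ᵇ a) ∧ descending (b ∷ rest)

singletonOK : List Tm → Bool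
singletonOK (Ω ∷ []) = false
singletonOK (ϑ _ ∷ []) = false
singletonOK _ = true

mutual
  wf : Tm → Bool
  wf Ω = true
  wf (ϑ a) = wf a
  wf ⟨ as ⟩ = wfs as ∧ descending as ∧ singletonOK as

  wfs : List Tm → Bool
  wfs [] = true
  wfs (a ∷ as) = wf a ∧ wfs as

WF : Tm → Set
WF a = T (wf a)

zeroᵗ : Tm
zeroᵗ = ⟨ [] ⟩

numᵗ : ℕ → Tm
numᵗ n = ⟨ replicate n zeroᵗ ⟩

ωᵗ : Tm
ωᵗ = ⟨ numᵗ 1 ∷ [] ⟩

-- identify Ω, ϑα with ⟨Ω⟩, ⟨ϑα⟩
toL : Tm → List Tm
toL Ω = Ω ∷ []
toL (ϑ a) = ϑ a ∷ []
toL ⟨ as ⟩ = as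

fromL : List Tm → Tm
fromL (Ω ∷ []) = Ω
fromL (ϑ a ∷ []) = ϑ a
fromL as = ⟨ as ⟩

keepUpToLast : (Tm → Bool) → List Tm → List Tm
keepUpToLast p [] = []
keepUpToLast p (a ∷ as) with keepUpToLast p as
... | [] = if p a then a ∷ [] else []
... | r@(_ ∷ _) = a ∷ r

_+ᵗ_ : Tm → Tm → Tm
a +ᵗ b with toL b
... | [] = a
... | b₀ ∷ bs = fromL (keepUpToLast (λ x → b₀ ≤ᵇ x) (toL a) ++ (b₀ ∷ bs))

infixl 6 _+ᵗ_

ω·_ : Tm → Tm
ω· Ω = Ω
ω· ϑ a = ϑ a
ω· ⟨ as ⟩ = ⟨ map (λ a → numᵗ 1 +ᵗ a) as ⟩

ωf : Tm → Tm
ωf Ω = Ω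
ωf (ϑ a) = ϑ a
ωf ⟨ as ⟩ = ⟨ ⟨ as ⟩ ∷ [] ⟩

maxᵗ : Tm → Tm → Tm
maxᵗ a b = if a ≤ᵇ b then b else a

Pred : Set₁
Pred = Tm → Set

_⊆_ : Pred → Pred → Set
A ⊆ B = ∀ x → A x → B x

_∪_ : Pred → Pred → Pred
(A ∪ B) x = A x ⊎ B x

∅ : Pred
∅ _ = ⊥

｛_｝ : Tm → Pred
｛ a ｝ x = x ≡ a

data C (α β : Tm) : Tm → Set where
  cΩ  : C α β Ω
  c≺  : ∀ {γ} → WF γ → γ ≺ β → C α β γ
  cϑ  : ∀ {γ} → C α β γ → γ ≺ α → C α β (ϑ γ)
  c⟨⟩ : ∀ {γs} → All (C α β) γs → WF ⟨ γs ⟩ → C α β ⟨ γs ⟩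

-- H_α(Y) = ⋂{ C_γ(δ) | α ≺ γ, Y ⊆ C_γ(δ) }  (all terms if no such γ, δ)
H : Tm → Pred → Pred
H α Y β = WF β × (∀ γ δ → WF γ → WF δ → α ≺ γ → Y ⊆ C γ δ → C γ δ β)

Op : Set₁
Op = Pred → Pred

_[_] : Op → Pred → Op
(𝓗 [ Z ]) Y = 𝓗 (Z ∪ Y)

H[_,_] : Tm → Pred → Op
H[ α , X ] = H α [ X ]

data ATm (n : ℕ) : Set where
  var : Fin n → ATm n
  𝟎   : ATm n
  S   : ATm n → ATm n
  _⊕_ : ATm n → ATm n → ATm n
  _⊗_ : ATm n → ATm n → ATm n

renA : ∀ {m n} → (Fin m → Fin n) → ATm m → ATm n
renA ρ (var i) = var (ρ i)
renA ρ 𝟎 = 𝟎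
renA ρ (S t) = S (renA ρ t)
renA ρ (s ⊕ t) = renA ρ s ⊕ renA ρ t
renA ρ (s ⊗ t) = renA ρ s ⊗ renA ρ t

substA : ∀ {m n} → (Fin m → ATm n) → ATm m → ATm n
substA σ (var i) = σ i
substA σ 𝟎 = 𝟎
substA σ (S t) = S (substA σ t)
substA σ (s ⊕ t) = substA σ s ⊕ substA σ t
substA σ (s ⊗ t) = substA σ s ⊗ substA σ t

exts : ∀ {m n} → (Fin m → ATm n) → Fin (ns m) → ATm (ns n)
exts σ fz = var fz
exts σ (fs i) = renA fs (σ i)

evalA : ATm 0 → ℕ
evalA (var ())
evalA 𝟎 = 0
evalA (S t) = ns (evalA t)
evalA (s ⊕ t) = evalA s +ℕ evalA t
evalA (s ⊗ t) = evalA s *ℕ evalA t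

numA : ∀ {n} → ℕ → ATm n
numA nz = 𝟎
numA (ns k) = S (numA k)

-- Operator forms: arithmetic formulas (NNF) with an extra unary predicate X
-- occurring only positively; an operator form is an  OF 1  (free variable x).
data OF (n : ℕ) : Set where
  _≐_  : ATm n → ATm n → OF n
  _≠̇_  : ATm n → ATm n → OF n
  X    : ATm n → OF n
  _∧̇_  : OF n → OF n → OF n
  _∨̇_  : OF n → OF n → OF n
  ∀̇    : OF (ns n) → OF n
  ∃̇    : OF (ns n) → OF n

-- Formulas of L^Ω_ID (NNF), n free number variables.
-- I α φ t  is  I^{≺α}_φ t,   ¬I α φ t  is  ¬ I^{≺α}_φ t.
data Fm (n : ℕ) : Set where
  _≐_  : ATm n → ATm n → Fm n
  _≠̇_  : ATm n → ATm n → Fm n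
  I    : Tm → OF 1 → ATm n → Fm n
  ¬I   : Tm → OF 1 → ATm n → Fm n
  _∧̇_  : Fm n → Fm n → Fm n
  _∨̇_  : Fm n → Fm n → Fm n
  ∀̇    : Fm (ns n) → Fm n
  ∃̇    : Fm (ns n) → Fm n

substF : ∀ {m n} → (Fin m → ATm n) → Fm m → Fm n
substF σ (s ≐ t) = substA σ s ≐ substA σ t
substF σ (s ≠̇ t) = substA σ s ≠̇ substA σ t
substF σ (I a φ t) = I a φ (substA σ t)
substF σ (¬I a φ t) = ¬I a φ (substA σ t)
substF σ (ψ ∧̇ χ) = substF σ ψ ∧̇ substF σ χ
substF σ (ψ ∨̇ χ) = substF σ ψ ∨̇ substF σ χ
substF σ (∀̇ ψ) = ∀̇ (substF (exts σ) ψ)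
substF σ (∃̇ ψ) = ∃̇ (substF (exts σ) ψ)

instOF : ∀ {m n} → OF 1 → Tm → (Fin m → ATm n) → OF m → Fm n
instOF φ γ σ (s ≐ t) = substA σ s ≐ substA σ t
instOF φ γ σ (s ≠̇ t) = substA σ s ≠̇ substA σ t
instOF φ γ σ (X s) = I γ φ (substA σ s)
instOF φ γ σ (ψ ∧̇ χ) = instOF φ γ σ ψ ∧̇ instOF φ γ σ χ
instOF φ γ σ (ψ ∨̇ χ) = instOF φ γ σ ψ ∨̇ instOF φ γ σ χ
instOF φ γ σ (∀̇ ψ) = ∀̇ (instOF φ γ (exts σ) ψ)
instOF φ γ σ (∃̇ ψ) = ∃̇ (instOF φ γ (exts σ) ψ)

_⟦_,I≺_⟧ : ∀ {n} → OF 1 → ATm n → Tm → Fm n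
φ ⟦ t ,I≺ γ ⟧ = instOF φ γ (λ _ → t) φ

neg : ∀ {n} → Fm n → Fm n
neg (s ≐ t) = s ≠̇ t
neg (s ≠̇ t) = s ≐ t
neg (I a φ t) = ¬I a φ t
neg (¬I a φ t) = I a φ t
neg (ψ ∧̇ χ) = neg ψ ∨̇ neg χ
neg (ψ ∨̇ χ) = neg ψ ∧̇ neg χ
neg (∀̇ ψ) = ∃̇ (neg ψ)
neg (∃̇ ψ) = ∀̇ (neg ψ)

k : ∀ {n} → Fm n → List Tm
k (s ≐ t) = []
k (s ≠̇ t) = []
k (I a φ t) = a ∷ []
k (¬I a φ t) = a ∷ []
k (ψ ∧̇ χ) = k ψ ++ k χ
k (ψ ∨̇ χ) = k ψ ++ k χ
k (∀̇ ψ) = k ψ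
k (∃̇ ψ) = k ψ

rk : ∀ {n} → Fm n → Tm
rk (s ≐ t) = zeroᵗ
rk (s ≠̇ t) = zeroᵗ
rk (I a φ t) = ω· a
rk (¬I a φ t) = ω· a
rk (ψ ∧̇ χ) = maxᵗ (rk ψ) (rk χ) +ᵗ numᵗ 1
rk (ψ ∨̇ χ) = maxᵗ (rk ψ) (rk χ) +ᵗ numᵗ 1
rk (∀̇ ψ) = rk ψ +ᵗ numᵗ 1
rk (∃̇ ψ) = rk ψ +ᵗ numᵗ 1

Sentence : Set
Sentence = Fm 0

IsSentence : Sentence → Set
IsSentence ψ = All (λ a → WF a × a ≼ Ω) (k ψ)

NoNegIΩ : ∀ {n} → Fm n → Set
NoNegIΩ (s ≐ t) = ⊤
NoNegIΩ (s ≠̇ t) = ⊤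
NoNegIΩ (I a φ t) = ⊤
NoNegIΩ (¬I a φ t) = a ≢ Ω
NoNegIΩ (ψ ∧̇ χ) = NoNegIΩ ψ × NoNegIΩ χ
NoNegIΩ (ψ ∨̇ χ) = NoNegIΩ ψ × NoNegIΩ χ
NoNegIΩ (∀̇ ψ) = NoNegIΩ ψ
NoNegIΩ (∃̇ ψ) = NoNegIΩ ψ

ΣΩ-Sequent : List Sentence → Set
ΣΩ-Sequent Γ = All (λ ψ → IsSentence ψ × NoNegIΩ ψ) Γ

-- Assignment of disjunctions / conjunctions.
-- ⋁ δ f  represents  ⋁_{γ≺δ} f γ  (only the values at γ ≺ δ matter).

data Junction : Set where
  ⋁ : Tm → (Tm → Sentence) → Junction
  ⋀ : Tm → (Tm → Sentence) → Junction

toℕᵗ : Tm → ℕ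
toℕᵗ ⟨ as ⟩ = length as
toℕᵗ _ = 0

pick2 : Sentence → Sentence → Tm → Sentence
pick2 ψ₀ ψ₁ γ = if γ ≡ᵗ zeroᵗ then ψ₀ else ψ₁

junction : Sentence → Junction
junction (s ≐ t) =
  if evalA s ≡ᵇ evalA t then ⋀ zeroᵗ (λ _ → s ≐ t) else ⋁ zeroᵗ (λ _ → s ≐ t)
junction (s ≠̇ t) =
  if evalA s ≡ᵇ evalA t then ⋁ zeroᵗ (λ _ → s ≠̇ t) else ⋀ zeroᵗ (λ _ → s ≠̇ t)
junction (I a φ t) = ⋁ a (λ γ → φ ⟦ t ,I≺ γ ⟧)
junction (¬I a φ t) = ⋀ a (λ γ → neg (φ ⟦ t ,I≺ γ ⟧))
junction (ψ ∧̇ χ) = ⋀ (numᵗ 2) (pick2 ψ χ)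
junction (ψ ∨̇ χ) = ⋁ (numᵗ 2) (pick2 ψ χ)
junction (∀̇ ψ) = ⋀ ωᵗ (λ γ → substF (λ _ → numA (toℕᵗ γ)) ψ)
junction (∃̇ ψ) = ⋁ ωᵗ (λ γ → substF (λ _ → numA (toℕᵗ γ)) ψ)

Side : Op → Tm → List Sentence → Set
Side 𝓗 α Γ = 𝓗 ∅ α × (∀ {ψ} → ψ ∈ Γ → All (𝓗 ∅) (k ψ))

data _⊢[_,_]_ : Op → Tm → Tm → List Sentence → Set₁ where
  ⋀-rule : ∀ {𝓗 α ρ Γ ψ δ f} → Side 𝓗 α Γ →
    ψ ∈ Γ → junction ψ ≡ ⋀ δ f →
    (∀ γ → WF γ → γ ≺ δ →
       Σ Tm λ α′ → α′ ≺ α × ((𝓗 [ ｛ γ ｝ ]) ⊢[ α′ , ρ ] (f γ ∷ Γ))) →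
    𝓗 ⊢[ α , ρ ] Γ
  ⋁-rule : ∀ {𝓗 α ρ Γ ψ δ f γ α′} → Side 𝓗 α Γ →
    ψ ∈ Γ → junction ψ ≡ ⋁ δ f →
    WF γ → γ ≺ δ → γ ≺ α → 𝓗 ∅ γ →
    α′ ≺ α → 𝓗 ⊢[ α′ , ρ ] (f γ ∷ Γ) →
    𝓗 ⊢[ α , ρ ] Γ
  cut : ∀ {𝓗 α ρ Γ α′} (ψ : Sentence) → Side 𝓗 α Γ →
    IsSentence ψ → rk ψ ≺ ρ → α′ ≺ α →
    𝓗 ⊢[ α′ , ρ ] (ψ ∷ Γ) → 𝓗 ⊢[ α′ , ρ ] (neg ψ ∷ Γ) →
    𝓗 ⊢[ α , ρ ] Γ
  fix : ∀ {𝓗 α ρ Γ φ t α′} → Side 𝓗 α Γ →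
    Ω ≼ α → I Ω φ t ∈ Γ → α′ ≺ α →
    𝓗 ⊢[ α′ , ρ ] ((φ ⟦ t ,I≺ Ω ⟧) ∷ Γ) →
    𝓗 ⊢[ α , ρ ] Γ

-- Induction on the derivation, generalised to sequents Γ′ that represent Γ, where a negative literal
-- ¬I^{≺Ω}_φ t may be represented by ¬I^{≺λ}_φ t for some λ ≺ Ω in H_α(X). The engine is the collapsing
-- property C_η(ϑη) ∩ Ω ⊆ ϑη: for η ≻ α every element of H_α(X) below Ω lies below ϑη. Hence the indices
-- of inferences and the ranks of cuts free of I^{≺Ω} stay below ϑη, and a premise of height β₀ ≺ β
-- collapses to height ϑ(α + ω(β₀)) ≺ ϑ(α + ω(β)). A cut on I^{≺Ω}_φ t (the only cut formulas of rank
-- ≥ Ω below Ω + 1) becomes a cut on I^{≺ϑη₀}_φ t, η₀ = α + ω(β₀): the collapsed left premise is lowered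
-- by boundedness, and the right premise is collapsed once more above η₀ with ¬I^{≺Ω}_φ t represented by
-- ¬I^{≺ϑη₀}_φ t, giving height ϑ(η₀ + ω(β₀)) ≺ ϑη. Likewise Fix becomes a ⋁-inference with witness ϑη₀.

module Submission where

open import Data.Bool using (Bool; true; false; _∧_; _∨_; if_then_else_; T)
open import Data.Empty using (⊥; ⊥-elim)
open import Data.Fin using (Fin)
open import Data.List using (List; []; _∷_; _++_)
open import Data.List.Properties using (++-assoc)
open import Data.List.Membership.Propositional using (_∈_)
open import Data.List.Membership.Propositional.Properties using (∈-++⁺ˡ; ∈-++⁺ʳ; ∈-++⁻)
open import Data.List.Relation.Unary.All using (All; []; _∷_; lookup; tabulate; universal)
  renaming (map to All-map)
import Data.List.Relation.Unary.All.Properties as All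
open import Data.List.Relation.Unary.Any using (here; there)
open import Data.Nat using (suc; _≡ᵇ_)
open import Data.Product using (Σ; _×_; _,_; proj₁; proj₂)
open import Data.Sum using (_⊎_; inj₁; inj₂; [_,_]′)
open import Data.Unit using (⊤; tt)
open import Relation.Binary.PropositionalEquality using (_≡_; _≢_; refl; sym; trans; cong; cong₂; subst)

open import Defs

T-∨⁺ˡ : ∀ {x} y → T x → T (x ∨ y)
T-∨⁺ˡ {true} _ _ = tt

T-∨⁺ʳ : ∀ x {y} → T y → T (x ∨ y)
T-∨⁺ʳ true _ = tt
T-∨⁺ʳ false p = p

T-∨-case : ∀ {A : Set} x {y} → T (x ∨ y) → (T x → A) → (T y → A) → A
T-∨-case true _ f _ = f tt
T-∨-case false p _ g = g p

T-∧⁺ : ∀ {x y} → T x → T y → T (x ∧ y)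
T-∧⁺ {true} _ q = q

T-∧⁻ˡ : ∀ x {y} → T (x ∧ y) → T x
T-∧⁻ˡ true _ = tt

T-∧⁻ʳ : ∀ x {y} → T (x ∧ y) → T y
T-∧⁻ʳ true p = p

T⇒≡true : ∀ {b} → T b → b ≡ true
T⇒≡true {true} _ = refl

≡false⇒¬T : ∀ {b} → b ≡ false → T b → ⊥
≡false⇒¬T {true} () _

mutual
  ≡ᵗ⇒≡ : ∀ a b → T (a ≡ᵗ b) → a ≡ b
  ≡ᵗ⇒≡ Ω Ω _ = refl
  ≡ᵗ⇒≡ (ϑ a) (ϑ b) p = cong ϑ (≡ᵗ⇒≡ a b p)
  ≡ᵗ⇒≡ ⟨ as ⟩ ⟨ bs ⟩ p = cong ⟨_⟩ (≡ˡ⇒≡ as bs p)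
  ≡ᵗ⇒≡ Ω (ϑ _) ()
  ≡ᵗ⇒≡ Ω ⟨ _ ⟩ ()
  ≡ᵗ⇒≡ (ϑ _) Ω ()
  ≡ᵗ⇒≡ (ϑ _) ⟨ _ ⟩ ()
  ≡ᵗ⇒≡ ⟨ _ ⟩ Ω ()
  ≡ᵗ⇒≡ ⟨ _ ⟩ (ϑ _) ()

  ≡ˡ⇒≡ : ∀ as bs → T (as ≡ˡ bs) → as ≡ bs
  ≡ˡ⇒≡ [] [] _ = refl
  ≡ˡ⇒≡ (a ∷ as) (b ∷ bs) p =
    cong₂ _∷_ (≡ᵗ⇒≡ a b (T-∧⁻ˡ (a ≡ᵗ b) p)) (≡ˡ⇒≡ as bs (T-∧⁻ʳ (a ≡ᵗ b) p))
  ≡ˡ⇒≡ [] (_ ∷ _) ()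
  ≡ˡ⇒≡ (_ ∷ _) [] ()

mutual
  ≡ᵗ-refl : ∀ a → T (a ≡ᵗ a)
  ≡ᵗ-refl Ω = tt
  ≡ᵗ-refl (ϑ a) = ≡ᵗ-refl a
  ≡ᵗ-refl ⟨ as ⟩ = ≡ˡ-refl as

  ≡ˡ-refl : ∀ as → T (as ≡ˡ as)
  ≡ˡ-refl [] = tt
  ≡ˡ-refl (a ∷ as) = T-∧⁺ (≡ᵗ-refl a) (≡ˡ-refl as)

≡ᵗ∧⇒≡ : ∀ a b {c} → T ((a ≡ᵗ b) ∧ c) → a ≡ b
≡ᵗ∧⇒≡ a b p = ≡ᵗ⇒≡ a b (T-∧⁻ˡ (a ≡ᵗ b) p)

≼-refl : ∀ a → a ≼ a
≼-refl a = T-∨⁺ʳ (a <ᵇ a) (≡ᵗ-refl a)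

≡⇒≼ : ∀ {a b} → a ≡ b → a ≼ b
≡⇒≼ {a} refl = ≼-refl a

≺⇒≼ : ∀ a b → a ≺ b → a ≼ b
≺⇒≼ a b p = T-∨⁺ˡ (a ≡ᵗ b) p

≼⇒≺⊎≡ : ∀ a b → a ≼ b → a ≺ b ⊎ a ≡ b
≼⇒≺⊎≡ a b p = T-∨-case (a <ᵇ b) p inj₁ (λ e → inj₂ (≡ᵗ⇒≡ a b e))

≮zero : ∀ a → a ≺ zeroᵗ → ⊥
≮zero Ω ()
≮zero (ϑ _) ()
≮zero ⟨ [] ⟩ ()
≮zero ⟨ _ ∷ _ ⟩ ()

lex-≮[] : ∀ as → T (lex as []) → ⊥
lex-≮[] [] ()
lex-≮[] (_ ∷ _) ()

lex-head-≼ : ∀ a as b bs → T (lex (a ∷ as) (b ∷ bs)) → a ≼ b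
lex-head-≼ a _ b _ p = T-∨-case (a <ᵇ b) p (≺⇒≼ a b) (λ e → ≡⇒≼ (≡ᵗ∧⇒≡ a b e))

mutual
  ≺-trans : ∀ x y z → x ≺ y → y ≺ z → x ≺ z
  ≺-trans Ω Ω _ () _
  ≺-trans Ω (ϑ _) _ () _
  ≺-trans Ω ⟨ [] ⟩ _ () _
  ≺-trans Ω ⟨ b ∷ _ ⟩ Ω p q = ⊥-elim (≼-≺-trans Ω b Ω p q)
  ≺-trans Ω ⟨ b ∷ _ ⟩ (ϑ c) p q = ≼-≺-trans Ω b (ϑ c) p q
  ≺-trans Ω ⟨ _ ∷ _ ⟩ ⟨ [] ⟩ _ ()
  ≺-trans Ω ⟨ b ∷ bs ⟩ ⟨ c ∷ cs ⟩ p q = ≼-trans Ω b c p (lex-head-≼ b bs c cs q)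
  ≺-trans (ϑ _) Ω Ω _ ()
  ≺-trans (ϑ _) Ω (ϑ _) _ ()
  ≺-trans (ϑ _) Ω ⟨ [] ⟩ _ ()
  ≺-trans (ϑ a) Ω ⟨ c ∷ _ ⟩ p q = ≺⇒≼ (ϑ a) c (≺-≼-trans (ϑ a) Ω c p q)
  ≺-trans (ϑ _) (ϑ _) Ω _ _ = tt
  ≺-trans (ϑ a) (ϑ b) (ϑ c) p q = ϑ-trans a b c p q
  ≺-trans (ϑ _) (ϑ _) ⟨ [] ⟩ _ ()
  ≺-trans (ϑ a) (ϑ b) ⟨ c ∷ _ ⟩ p q = ≺⇒≼ (ϑ a) c (≺-≼-trans (ϑ a) (ϑ b) c p q)
  ≺-trans (ϑ _) ⟨ [] ⟩ _ () _
  ≺-trans (ϑ _) ⟨ _ ∷ _ ⟩ Ω _ _ = tt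
  ≺-trans (ϑ a) ⟨ b ∷ _ ⟩ (ϑ c) p q = ≼-≺-trans (ϑ a) b (ϑ c) p q
  ≺-trans (ϑ _) ⟨ _ ∷ _ ⟩ ⟨ [] ⟩ _ ()
  ≺-trans (ϑ a) ⟨ b ∷ bs ⟩ ⟨ c ∷ cs ⟩ p q = ≼-trans (ϑ a) b c p (lex-head-≼ b bs c cs q)
  ≺-trans ⟨ [] ⟩ _ Ω _ _ = tt
  ≺-trans ⟨ [] ⟩ _ (ϑ _) _ _ = tt
  ≺-trans ⟨ [] ⟩ y ⟨ [] ⟩ _ q = ⊥-elim (≮zero y q)
  ≺-trans ⟨ [] ⟩ _ ⟨ _ ∷ _ ⟩ _ _ = tt
  ≺-trans ⟨ _ ∷ _ ⟩ Ω Ω _ ()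
  ≺-trans ⟨ _ ∷ _ ⟩ Ω (ϑ _) _ ()
  ≺-trans ⟨ _ ∷ _ ⟩ Ω ⟨ [] ⟩ _ ()
  ≺-trans ⟨ a ∷ as ⟩ Ω ⟨ c ∷ cs ⟩ p q = T-∨⁺ˡ ((a ≡ᵗ c) ∧ lex as cs) (≺-≼-trans a Ω c p q)
  ≺-trans ⟨ a ∷ _ ⟩ (ϑ b) Ω p _ = ≺-trans a (ϑ b) Ω p tt
  ≺-trans ⟨ a ∷ _ ⟩ (ϑ b) (ϑ c) p q = ≺-trans a (ϑ b) (ϑ c) p q
  ≺-trans ⟨ _ ∷ _ ⟩ (ϑ _) ⟨ [] ⟩ _ ()
  ≺-trans ⟨ a ∷ as ⟩ (ϑ b) ⟨ c ∷ cs ⟩ p q = T-∨⁺ˡ ((a ≡ᵗ c) ∧ lex as cs) (≺-≼-trans a (ϑ b) c p q)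
  ≺-trans ⟨ _ ∷ _ ⟩ ⟨ [] ⟩ _ () _
  ≺-trans ⟨ a ∷ as ⟩ ⟨ b ∷ bs ⟩ Ω p q = ≼-≺-trans a b Ω (lex-head-≼ a as b bs p) q
  ≺-trans ⟨ a ∷ as ⟩ ⟨ b ∷ bs ⟩ (ϑ c) p q = ≼-≺-trans a b (ϑ c) (lex-head-≼ a as b bs p) q
  ≺-trans ⟨ _ ∷ _ ⟩ ⟨ _ ∷ _ ⟩ ⟨ [] ⟩ _ ()
  ≺-trans ⟨ a ∷ as ⟩ ⟨ b ∷ bs ⟩ ⟨ c ∷ cs ⟩ p q = lex-trans (a ∷ as) (b ∷ bs) (c ∷ cs) p q

  ϑ-trans : ∀ a b c → ϑ a ≺ ϑ b → ϑ b ≺ ϑ c → ϑ a ≺ ϑ c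
  ϑ-trans a b c p q =
    T-∨-case ((b <ᵇ c) ∧ allE< b (ϑ c)) q
      (λ bc → T-∨-case ((a <ᵇ b) ∧ allE< a (ϑ b)) p
         (λ ab → T-∨⁺ˡ (anyE≥ (ϑ a) c)
                    (T-∧⁺ (≺-trans a b c (T-∧⁻ˡ (a <ᵇ b) ab) (T-∧⁻ˡ (b <ᵇ c) bc))
                          (allE<-mono a (ϑ b) (ϑ c) (T-∧⁻ʳ (a <ᵇ b) ab) q)))
         (λ r → anyE≥∧allE<⇒≺ (ϑ a) b (ϑ c) r (T-∧⁻ʳ (b <ᵇ c) bc)))
      (λ r → T-∨⁺ʳ ((a <ᵇ c) ∧ allE< a (ϑ c)) (anyE≥-≺ (ϑ a) (ϑ b) c p r))

  lex-trans : ∀ as bs cs → T (lex as bs) → T (lex bs cs) → T (lex as cs)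
  lex-trans [] [] _ () _
  lex-trans [] (_ ∷ _) [] _ ()
  lex-trans [] (_ ∷ _) (_ ∷ _) _ _ = tt
  lex-trans (_ ∷ _) [] _ () _
  lex-trans (_ ∷ _) (_ ∷ _) [] _ ()
  lex-trans (a ∷ as) (b ∷ bs) (c ∷ cs) p q =
    T-∨-case (a <ᵇ b) p
      (λ ab → T-∨⁺ˡ ((a ≡ᵗ c) ∧ lex as cs) (≺-≼-trans a b c ab (lex-head-≼ b bs c cs q)))
      (λ e → T-∨-case (b <ᵇ c) q
         (λ bc → T-∨⁺ˡ ((a ≡ᵗ c) ∧ lex as cs) (subst (_≺ c) (sym (≡ᵗ∧⇒≡ a b e)) bc))
         (λ e′ → T-∨⁺ʳ (a <ᵇ c)
            (T-∧⁺ (subst (λ w → T (a ≡ᵗ w)) (trans (≡ᵗ∧⇒≡ a b e) (≡ᵗ∧⇒≡ b c e′)) (≡ᵗ-refl a))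
                  (lex-trans as bs cs (T-∧⁻ʳ (a ≡ᵗ b) e) (T-∧⁻ʳ (b ≡ᵗ c) e′)))))

  ≼-≺-trans : ∀ x y z → x ≼ y → y ≺ z → x ≺ z
  ≼-≺-trans x y z p q =
    T-∨-case (x <ᵇ y) p (λ xy → ≺-trans x y z xy q)
                        (λ e → subst (_≺ z) (sym (≡ᵗ⇒≡ x y e)) q)

  ≺-≼-trans : ∀ x y z → x ≺ y → y ≼ z → x ≺ z
  ≺-≼-trans x y z p q =
    T-∨-case (y <ᵇ z) q (λ yz → ≺-trans x y z p yz)
                        (λ e → subst (x ≺_) (≡ᵗ⇒≡ y z e) p)

  ≼-trans : ∀ x y z → x ≼ y → y ≼ z → x ≼ z
  ≼-trans x y z p q =
    T-∨-case (x <ᵇ y) p (λ xy → ≺⇒≼ x z (≺-≼-trans x y z xy q))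
                        (λ e → subst (_≼ z) (sym (≡ᵗ⇒≡ x y e)) q)

  allE<-mono : ∀ a y z → T (allE< a y) → y ≺ z → T (allE< a z)
  allE<-mono Ω _ _ _ _ = tt
  allE<-mono (ϑ a) y z p q = ≺-trans (ϑ a) y z p q
  allE<-mono ⟨ as ⟩ y z p q = allEs<-mono as y z p q

  allEs<-mono : ∀ as y z → T (allEs< as y) → y ≺ z → T (allEs< as z)
  allEs<-mono [] _ _ _ _ = tt
  allEs<-mono (a ∷ as) y z p q =
    T-∧⁺ (allE<-mono a y z (T-∧⁻ˡ (allE< a y) p) q) (allEs<-mono as y z (T-∧⁻ʳ (allE< a y) p) q)

  anyE≥-≺ : ∀ x y c → x ≺ y → T (anyE≥ y c) → T (anyE≥ x c)
  anyE≥-≺ _ _ Ω _ ()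
  anyE≥-≺ x y (ϑ c) p q = ≺⇒≼ x (ϑ c) (≺-≼-trans x y (ϑ c) p q)
  anyE≥-≺ x y ⟨ cs ⟩ p q = anyEs≥-≺ x y cs p q

  anyEs≥-≺ : ∀ x y cs → x ≺ y → T (anyEs≥ y cs) → T (anyEs≥ x cs)
  anyEs≥-≺ _ _ [] _ ()
  anyEs≥-≺ x y (c ∷ cs) p q =
    T-∨-case (anyE≥ y c) q (λ r → T-∨⁺ˡ (anyEs≥ x cs) (anyE≥-≺ x y c p r))
                           (λ r → T-∨⁺ʳ (anyE≥ x c) (anyEs≥-≺ x y cs p r))

  anyE≥∧allE<⇒≺ : ∀ x b z → T (anyE≥ x b) → T (allE< b z) → x ≺ z
  anyE≥∧allE<⇒≺ _ Ω _ () _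
  anyE≥∧allE<⇒≺ x (ϑ b) z p q = ≼-≺-trans x (ϑ b) z p q
  anyE≥∧allE<⇒≺ x ⟨ bs ⟩ z p q = anyEs≥∧allEs<⇒≺ x bs z p q

  anyEs≥∧allEs<⇒≺ : ∀ x bs z → T (anyEs≥ x bs) → T (allEs< bs z) → x ≺ z
  anyEs≥∧allEs<⇒≺ _ [] _ () _
  anyEs≥∧allEs<⇒≺ x (b ∷ bs) z p q =
    T-∨-case (anyE≥ x b) p (λ r → anyE≥∧allE<⇒≺ x b z r (T-∧⁻ˡ (allE< b z) q))
                           (λ r → anyEs≥∧allEs<⇒≺ x bs z r (T-∧⁻ʳ (allE< b z) q))

Trichotomous : Tm → Tm → Set
Trichotomous x y = x ≺ y ⊎ x ≡ y ⊎ y ≺ x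

Trichotomous-sym : ∀ {x y} → Trichotomous x y → Trichotomous y x
Trichotomous-sym (inj₁ p) = inj₂ (inj₂ p)
Trichotomous-sym (inj₂ (inj₁ refl)) = inj₂ (inj₁ refl)
Trichotomous-sym (inj₂ (inj₂ p)) = inj₁ p

Trichotomous-Ω∷ : ∀ b bs → Trichotomous Ω b → Trichotomous Ω ⟨ b ∷ bs ⟩
Trichotomous-Ω∷ b bs (inj₁ p) = inj₁ (≺⇒≼ Ω b p)
Trichotomous-Ω∷ b bs (inj₂ (inj₁ refl)) = inj₁ (≼-refl Ω)
Trichotomous-Ω∷ b bs (inj₂ (inj₂ p)) = inj₂ (inj₂ p)

Trichotomous-ϑ∷ : ∀ a b bs → Trichotomous (ϑ a) b → Trichotomous (ϑ a) ⟨ b ∷ bs ⟩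
Trichotomous-ϑ∷ a b bs (inj₁ p) = inj₁ (≺⇒≼ (ϑ a) b p)
Trichotomous-ϑ∷ a b bs (inj₂ (inj₁ refl)) = inj₁ (≼-refl (ϑ a))
Trichotomous-ϑ∷ a b bs (inj₂ (inj₂ p)) = inj₂ (inj₂ p)

Trichotomous-⟨⟩ : ∀ as bs → T (lex as bs) ⊎ as ≡ bs ⊎ T (lex bs as) → Trichotomous ⟨ as ⟩ ⟨ bs ⟩
Trichotomous-⟨⟩ [] [] _ = inj₂ (inj₁ refl)
Trichotomous-⟨⟩ [] (_ ∷ _) _ = inj₁ tt
Trichotomous-⟨⟩ (_ ∷ _) [] _ = inj₂ (inj₂ tt)
Trichotomous-⟨⟩ (_ ∷ _) (_ ∷ _) (inj₁ p) = inj₁ p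
Trichotomous-⟨⟩ (_ ∷ _) (_ ∷ _) (inj₂ (inj₁ e)) = inj₂ (inj₁ (cong ⟨_⟩ e))
Trichotomous-⟨⟩ (_ ∷ _) (_ ∷ _) (inj₂ (inj₂ p)) = inj₂ (inj₂ p)

mutual
  ≺-trichotomy : ∀ x y → Trichotomous x y
  ≺-trichotomy Ω Ω = inj₂ (inj₁ refl)
  ≺-trichotomy Ω (ϑ _) = inj₂ (inj₂ tt)
  ≺-trichotomy Ω ⟨ [] ⟩ = inj₂ (inj₂ tt)
  ≺-trichotomy Ω ⟨ b ∷ bs ⟩ = Trichotomous-Ω∷ b bs (≺-trichotomy Ω b)
  ≺-trichotomy (ϑ _) Ω = inj₁ tt
  ≺-trichotomy (ϑ a) (ϑ b) = ϑ-trichotomy a b (≺-trichotomy a b)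
  ≺-trichotomy (ϑ _) ⟨ [] ⟩ = inj₂ (inj₂ tt)
  ≺-trichotomy (ϑ a) ⟨ b ∷ bs ⟩ = Trichotomous-ϑ∷ a b bs (≺-trichotomy (ϑ a) b)
  ≺-trichotomy ⟨ [] ⟩ Ω = inj₁ tt
  ≺-trichotomy ⟨ [] ⟩ (ϑ _) = inj₁ tt
  ≺-trichotomy ⟨ a ∷ as ⟩ Ω = Trichotomous-sym (Trichotomous-Ω∷ a as (≺-trichotomy Ω a))
  ≺-trichotomy ⟨ a ∷ as ⟩ (ϑ b) = Trichotomous-sym (Trichotomous-ϑ∷ b a as (≺-trichotomy (ϑ b) a))
  ≺-trichotomy ⟨ as ⟩ ⟨ bs ⟩ = Trichotomous-⟨⟩ as bs (lex-trichotomy as bs)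

  lex-trichotomy : ∀ as bs → T (lex as bs) ⊎ as ≡ bs ⊎ T (lex bs as)
  lex-trichotomy [] [] = inj₂ (inj₁ refl)
  lex-trichotomy [] (_ ∷ _) = inj₁ tt
  lex-trichotomy (_ ∷ _) [] = inj₂ (inj₂ tt)
  lex-trichotomy (a ∷ as) (b ∷ bs) with ≺-trichotomy a b
  ... | inj₁ ab = inj₁ (T-∨⁺ˡ ((a ≡ᵗ b) ∧ lex as bs) ab)
  ... | inj₂ (inj₂ ba) = inj₂ (inj₂ (T-∨⁺ˡ ((b ≡ᵗ a) ∧ lex bs as) ba))
  ... | inj₂ (inj₁ refl) with lex-trichotomy as bs
  ...   | inj₁ l = inj₁ (T-∨⁺ʳ (a <ᵇ a) (T-∧⁺ (≡ᵗ-refl a) l))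
  ...   | inj₂ (inj₁ refl) = inj₂ (inj₁ refl)
  ...   | inj₂ (inj₂ l) = inj₂ (inj₂ (T-∨⁺ʳ (a <ᵇ a) (T-∧⁺ (≡ᵗ-refl a) l)))

  allE<⊎anyE≥ : ∀ a y → T (allE< a y) ⊎ T (anyE≥ y a)
  allE<⊎anyE≥ Ω _ = inj₁ tt
  allE<⊎anyE≥ (ϑ a) y with ≺-trichotomy (ϑ a) y
  ... | inj₁ p = inj₁ p
  ... | inj₂ (inj₁ refl) = inj₂ (≼-refl (ϑ a))
  ... | inj₂ (inj₂ p) = inj₂ (≺⇒≼ y (ϑ a) p)
  allE<⊎anyE≥ ⟨ as ⟩ y = allEs<⊎anyEs≥ as y

  allEs<⊎anyEs≥ : ∀ as y → T (allEs< as y) ⊎ T (anyEs≥ y as)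
  allEs<⊎anyEs≥ [] _ = inj₁ tt
  allEs<⊎anyEs≥ (a ∷ as) y with allE<⊎anyE≥ a y
  ... | inj₂ p = inj₂ (T-∨⁺ˡ (anyEs≥ y as) p)
  ... | inj₁ p with allEs<⊎anyEs≥ as y
  ...   | inj₁ q = inj₁ (T-∧⁺ p q)
  ...   | inj₂ q = inj₂ (T-∨⁺ʳ (anyE≥ y a) q)

  ϑ-trichotomy : ∀ a b → Trichotomous a b → Trichotomous (ϑ a) (ϑ b)
  ϑ-trichotomy a b (inj₂ (inj₁ refl)) = inj₂ (inj₁ refl)
  ϑ-trichotomy a b (inj₁ ab) with allE<⊎anyE≥ a (ϑ b)
  ... | inj₁ al = inj₁ (T-∨⁺ˡ (anyE≥ (ϑ a) b) (T-∧⁺ ab al))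
  ... | inj₂ an = inj₂ (inj₂ (T-∨⁺ʳ ((b <ᵇ a) ∧ allE< b (ϑ a)) an))
  ϑ-trichotomy a b (inj₂ (inj₂ ba)) with allE<⊎anyE≥ b (ϑ a)
  ... | inj₁ al = inj₂ (inj₂ (T-∨⁺ˡ (anyE≥ (ϑ b) a) (T-∧⁺ ba al)))
  ... | inj₂ an = inj₁ (T-∨⁺ʳ ((a <ᵇ b) ∧ allE< a (ϑ b)) an)

¬≼⇒≻ : ∀ b m → (b ≼ m → ⊥) → m ≺ b
¬≼⇒≻ b m b⋠m with ≺-trichotomy m b
... | inj₁ p = p
... | inj₂ (inj₁ refl) = ⊥-elim (b⋠m (≼-refl m))
... | inj₂ (inj₂ p) = ⊥-elim (b⋠m (≺⇒≼ b m p))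

-- keepStep and keep form a structurally recursive copy of keepUpToLast, easier to reason about than
-- its with-definition.
keepStep : (Tm → Bool) → Tm → List Tm → List Tm
keepStep p a [] = if p a then a ∷ [] else []
keepStep p a (r ∷ rs) = a ∷ r ∷ rs

keep : (Tm → Bool) → List Tm → List Tm
keep p [] = []
keep p (a ∷ as) = keepStep p a (keep p as)

keepUpToLast≡keep : ∀ p as → keepUpToLast p as ≡ keep p as
keepUpToLast≡keep p [] = refl
keepUpToLast≡keep p (a ∷ as) with keepUpToLast p as | keepUpToLast≡keep p as
... | [] | e rewrite sym e = refl
... | _ ∷ _ | e rewrite sym e = refl

HeadFails : (Tm → Bool) → List Tm → Set
HeadFails p [] = ⊤
HeadFails p (m ∷ _) = T (p m) → ⊥

LastSatisfies : (Tm → Bool) → List Tm → Set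
LastSatisfies p [] = ⊤
LastSatisfies p (x ∷ []) = T (p x)
LastSatisfies p (_ ∷ y ∷ r) = LastSatisfies p (y ∷ r)

keepStep-weaken : ∀ p q → (∀ x → T (p x) → T (q x)) → ∀ a kp kq M →
  kq ≡ kp ++ M → HeadFails p M →
  Σ (List Tm) λ M′ → (keepStep q a kq ≡ keepStep p a kp ++ M′) × HeadFails p M′
keepStep-weaken p q p⇒q a (r ∷ rs) _ M refl h = M , refl , h
keepStep-weaken p q p⇒q a [] _ [] refl h with p a in eqp
... | true rewrite T⇒≡true (p⇒q a (subst T (sym eqp) tt)) = [] , refl , tt
... | false with q a
...   | true = a ∷ [] , refl , ≡false⇒¬T eqp
...   | false = [] , refl , tt
keepStep-weaken p q p⇒q a [] _ (m ∷ ms) refl h with p a in eqp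
... | true = m ∷ ms , refl , h
... | false = a ∷ m ∷ ms , refl , ≡false⇒¬T eqp

keep-weaken : ∀ p q → (∀ x → T (p x) → T (q x)) → ∀ as →
  Σ (List Tm) λ M → (keep q as ≡ keep p as ++ M) × HeadFails p M
keep-weaken p q p⇒q [] = [] , refl , tt
keep-weaken p q p⇒q (a ∷ as) with keep-weaken p q p⇒q as
... | M , e , h = keepStep-weaken p q p⇒q a (keep p as) (keep q as) M e h

keep-all : ∀ p as → All (λ x → T (p x)) as → keep p as ≡ as
keep-all p [] _ = refl
keep-all p (a ∷ as) (pa ∷ pas) rewrite keep-all p as pas = keepStep-∷ as
  where
  keepStep-∷ : ∀ l → keepStep p a l ≡ a ∷ l
  keepStep-∷ [] rewrite T⇒≡true pa = refl
  keepStep-∷ (_ ∷ _) = refl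

keep-∷ʳ : ∀ p as x → T (p x) → keep p (as ++ x ∷ []) ≡ as ++ x ∷ []
keep-∷ʳ p [] x px rewrite T⇒≡true px = refl
keep-∷ʳ p (a ∷ as) x px rewrite keep-∷ʳ p as x px = keepStep-nonempty as
  where
  keepStep-nonempty : ∀ l → keepStep p a (l ++ x ∷ []) ≡ a ∷ l ++ x ∷ []
  keepStep-nonempty [] = refl
  keepStep-nonempty (_ ∷ _) = refl

keep-prefix : ∀ p as → Σ (List Tm) λ M → (as ≡ keep p as ++ M) × HeadFails p M
keep-prefix p as with keep-weaken p (λ _ → true) (λ _ _ → tt) as
... | M , e , h = M , trans (sym (keep-all (λ _ → true) as (universal (λ _ → tt) as))) e , h

keep-last : ∀ p as → LastSatisfies p (keep p as)
keep-last p [] = tt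
keep-last p (a ∷ as) = keepStep-last (keep p as) (keep-last p as)
  where
  keepStep-last : ∀ k → LastSatisfies p k → LastSatisfies p (keepStep p a k)
  keepStep-last [] _ with p a in eqp
  ... | true = subst T (sym eqp) tt
  ... | false = tt
  keepStep-last (_ ∷ _) h = h

toL-fromL : ∀ l → toL (fromL l) ≡ l
toL-fromL [] = refl
toL-fromL (Ω ∷ []) = refl
toL-fromL (Ω ∷ _ ∷ _) = refl
toL-fromL (ϑ _ ∷ []) = refl
toL-fromL (ϑ _ ∷ _ ∷ _) = refl
toL-fromL (⟨ _ ⟩ ∷ _) = refl

lex-toL⇒≺ : ∀ x y → T (lex (toL x) (toL y)) → x ≺ y
lex-toL⇒≺ Ω Ω ()
lex-toL⇒≺ Ω (ϑ _) ()
lex-toL⇒≺ Ω ⟨ [] ⟩ ()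
lex-toL⇒≺ Ω ⟨ b ∷ bs ⟩ p = lex-head-≼ Ω [] b bs p
lex-toL⇒≺ (ϑ _) Ω _ = tt
lex-toL⇒≺ (ϑ a) (ϑ b) p = T-∨-case (ϑ a <ᵇ ϑ b) p (λ q → q) (λ e → ⊥-elim (T-∧⁻ʳ (a ≡ᵗ b) e))
lex-toL⇒≺ (ϑ _) ⟨ [] ⟩ ()
lex-toL⇒≺ (ϑ a) ⟨ b ∷ bs ⟩ p = lex-head-≼ (ϑ a) [] b bs p
lex-toL⇒≺ ⟨ [] ⟩ Ω _ = tt
lex-toL⇒≺ ⟨ [] ⟩ (ϑ _) _ = tt
lex-toL⇒≺ ⟨ [] ⟩ ⟨ _ ⟩ p = p
lex-toL⇒≺ ⟨ a ∷ as ⟩ Ω p =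
  T-∨-case (a <ᵇ Ω) p (λ q → q) (λ e → ⊥-elim (lex-≮[] as (T-∧⁻ʳ (a ≡ᵗ Ω) e)))
lex-toL⇒≺ ⟨ a ∷ as ⟩ (ϑ b) p =
  T-∨-case (a <ᵇ ϑ b) p (λ q → q) (λ e → ⊥-elim (lex-≮[] as (T-∧⁻ʳ (a ≡ᵗ ϑ b) e)))
lex-toL⇒≺ ⟨ _ ∷ _ ⟩ ⟨ _ ⟩ p = p

lex⇒≺fromL : ∀ x l → T (lex (toL x) l) → x ≺ fromL l
lex⇒≺fromL x l p = lex-toL⇒≺ x (fromL l) (subst (λ w → T (lex (toL x) w)) (sym (toL-fromL l)) p)

lex⇒fromL≺fromL : ∀ l l′ → T (lex l l′) → fromL l ≺ fromL l′
lex⇒fromL≺fromL l l′ p = lex⇒≺fromL (fromL l) l′ (subst (λ w → T (lex w l′)) (sym (toL-fromL l)) p)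

lex-++⁺ˡ : ∀ K R Q → T (lex R Q) → T (lex (K ++ R) (K ++ Q))
lex-++⁺ˡ [] R Q p = p
lex-++⁺ˡ (a ∷ K) R Q p = T-∨⁺ʳ (a <ᵇ a) (T-∧⁺ (≡ᵗ-refl a) (lex-++⁺ˡ K R Q p))

HeadFails⇒lex : ∀ b M {bs} → HeadFails (b ≤ᵇ_) M → T (lex M (b ∷ bs))
HeadFails⇒lex b [] _ = tt
HeadFails⇒lex b (m ∷ ms) {bs} h = T-∨⁺ˡ ((m ≡ᵗ b) ∧ lex ms bs) (¬≼⇒≻ b m h)

+ᵗ-∷ : ∀ a b b₀ bs → toL b ≡ b₀ ∷ bs → a +ᵗ b ≡ fromL (keep (b₀ ≤ᵇ_) (toL a) ++ b₀ ∷ bs)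
+ᵗ-∷ a Ω _ _ refl = cong (λ k → fromL (k ++ Ω ∷ [])) (keepUpToLast≡keep _ (toL a))
+ᵗ-∷ a (ϑ b) _ _ refl = cong (λ k → fromL (k ++ ϑ b ∷ [])) (keepUpToLast≡keep _ (toL a))
+ᵗ-∷ a ⟨ x ∷ xs ⟩ _ _ refl = cong (λ k → fromL (k ++ x ∷ xs)) (keepUpToLast≡keep _ (toL a))

infixl 30 _+ω_

_+ω_ : Tm → Tm → Tm
a +ω b = fromL (keep (b ≤ᵇ_) (toL a) ++ b ∷ [])

+ᵗωf≡+ω : ∀ a b → a +ᵗ ωf b ≡ a +ω b
+ᵗωf≡+ω a b = +ᵗ-∷ a (ωf b) b [] (toL-ωf b)
  where
  toL-ωf : ∀ b → toL (ωf b) ≡ b ∷ []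
  toL-ωf Ω = refl
  toL-ωf (ϑ _) = refl
  toL-ωf ⟨ _ ⟩ = refl

+ω-increasing : ∀ a b → a ≺ a +ω b
+ω-increasing a b with keep-prefix (b ≤ᵇ_) (toL a)
... | M , e , h = lex⇒≺fromL a (K ++ b ∷ [])
    (subst (λ w → T (lex w (K ++ b ∷ []))) (sym e) (lex-++⁺ˡ K M (b ∷ []) (HeadFails⇒lex b M h)))
  where
  K : List Tm
  K = keep (b ≤ᵇ_) (toL a)

+ω-twice≺ : ∀ a b₀ b → b₀ ≺ b → a +ω b₀ +ω b₀ ≺ a +ω b
+ω-twice≺ a b₀ b b₀≺b
  with keep-weaken (b ≤ᵇ_) (b₀ ≤ᵇ_) (λ x b≼x → ≺⇒≼ b₀ x (≺-≼-trans b₀ b x b₀≺b b≼x)) (toL a)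
... | M , e , h =
  subst (_≺ a +ω b) (sym twice)
    (lex⇒fromL≺fromL (K ++ twiceTail) (K ++ b ∷ []) (lex-++⁺ˡ K twiceTail (b ∷ []) (below M h)))
  where
  K : List Tm
  K = keep (b ≤ᵇ_) (toL a)
  twiceTail : List Tm
  twiceTail = (M ++ b₀ ∷ []) ++ b₀ ∷ []
  twice : a +ω b₀ +ω b₀ ≡ fromL (K ++ twiceTail)
  twice rewrite toL-fromL (keep (b₀ ≤ᵇ_) (toL a) ++ b₀ ∷ [])
              | keep-∷ʳ (b₀ ≤ᵇ_) (keep (b₀ ≤ᵇ_) (toL a)) b₀ (≼-refl b₀)
              | e | ++-assoc K M (b₀ ∷ []) | ++-assoc K (M ++ b₀ ∷ []) (b₀ ∷ []) = refl
  below : ∀ M → HeadFails (b ≤ᵇ_) M → T (lex ((M ++ b₀ ∷ []) ++ b₀ ∷ []) (b ∷ []))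
  below [] _ = T-∨⁺ˡ ((b₀ ≡ᵗ b) ∧ lex (b₀ ∷ []) []) b₀≺b
  below (m ∷ ms) h = HeadFails⇒lex b (m ∷ (ms ++ b₀ ∷ []) ++ b₀ ∷ []) h

+ω-monoʳ-≺ : ∀ a b₀ b → b₀ ≺ b → a +ω b₀ ≺ a +ω b
+ω-monoʳ-≺ a b₀ b b₀≺b =
  ≺-trans (a +ω b₀) (a +ω b₀ +ω b₀) (a +ω b) (+ω-increasing (a +ω b₀) b₀) (+ω-twice≺ a b₀ b b₀≺b)

WF-toL : ∀ a → WF a → T (wfs (toL a)) × T (descending (toL a))
WF-toL Ω _ = tt , tt
WF-toL (ϑ a) w = T-∧⁺ w tt , tt
WF-toL ⟨ as ⟩ w = T-∧⁻ˡ (wfs as) w , T-∧⁻ˡ (descending as) (T-∧⁻ʳ (wfs as) w)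

WF-fromL : ∀ l → T (wfs l) → T (descending l) → WF (fromL l)
WF-fromL [] _ _ = tt
WF-fromL (Ω ∷ []) _ _ = tt
WF-fromL (Ω ∷ _ ∷ _) w d = T-∧⁺ w (T-∧⁺ d tt)
WF-fromL (ϑ a ∷ []) w _ = T-∧⁻ˡ (wf a) w
WF-fromL (ϑ _ ∷ _ ∷ _) w d = T-∧⁺ w (T-∧⁺ d tt)
WF-fromL (⟨ _ ⟩ ∷ []) w d = T-∧⁺ w (T-∧⁺ d tt)
WF-fromL (⟨ _ ⟩ ∷ _ ∷ _) w d = T-∧⁺ w (T-∧⁺ d tt)

wfs-++⁻ˡ : ∀ K M → T (wfs (K ++ M)) → T (wfs K)
wfs-++⁻ˡ [] _ _ = tt
wfs-++⁻ˡ (a ∷ K) M w = T-∧⁺ (T-∧⁻ˡ (wf a) w) (wfs-++⁻ˡ K M (T-∧⁻ʳ (wf a) w))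

wfs-∷ʳ : ∀ K b → T (wfs K) → WF b → T (wfs (K ++ b ∷ []))
wfs-∷ʳ [] _ _ wb = T-∧⁺ wb tt
wfs-∷ʳ (a ∷ K) b w wb = T-∧⁺ (T-∧⁻ˡ (wf a) w) (wfs-∷ʳ K b (T-∧⁻ʳ (wf a) w) wb)

wfs⇒All : ∀ l → T (wfs l) → All WF l
wfs⇒All [] _ = []
wfs⇒All (a ∷ l) w = T-∧⁻ˡ (wf a) w ∷ wfs⇒All l (T-∧⁻ʳ (wf a) w)

descending-++⁻ˡ : ∀ K M → T (descending (K ++ M)) → T (descending K)
descending-++⁻ˡ [] _ _ = tt
descending-++⁻ˡ (_ ∷ []) _ _ = tt
descending-++⁻ˡ (a ∷ b ∷ K) M d =
  T-∧⁺ (T-∧⁻ˡ (b ≤ᵇ a) d) (descending-++⁻ˡ (b ∷ K) M (T-∧⁻ʳ (b ≤ᵇ a) d))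

descending-∷ʳ : ∀ K b → T (descending K) → LastSatisfies (b ≤ᵇ_) K → T (descending (K ++ b ∷ []))
descending-∷ʳ [] _ _ _ = tt
descending-∷ʳ (_ ∷ []) _ _ l = T-∧⁺ l tt
descending-∷ʳ (a ∷ c ∷ K) b d l =
  T-∧⁺ (T-∧⁻ˡ (c ≤ᵇ a) d) (descending-∷ʳ (c ∷ K) b (T-∧⁻ʳ (c ≤ᵇ a) d) l)

descending⇒≼head : ∀ a as → T (descending (a ∷ as)) → All (_≼ a) (a ∷ as)
descending⇒≼head a [] _ = ≼-refl a ∷ []
descending⇒≼head a (b ∷ as) d =
  ≼-refl a ∷ All-map (λ {x} x≼b → ≼-trans x b a x≼b (T-∧⁻ˡ (b ≤ᵇ a) d))
                     (descending⇒≼head b as (T-∧⁻ʳ (b ≤ᵇ a) d))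

+ω-entries : ∀ a b → WF a → WF b →
  let l = keep (b ≤ᵇ_) (toL a) ++ b ∷ [] in T (wfs l) × T (descending l)
+ω-entries a b wa wb with keep-prefix (b ≤ᵇ_) (toL a) | WF-toL a wa
... | M , e , _ | w , d =
  wfs-∷ʳ K b (wfs-++⁻ˡ K M (subst (λ l → T (wfs l)) e w)) wb ,
  descending-∷ʳ K b (descending-++⁻ˡ K M (subst (λ l → T (descending l)) e d)) (keep-last (b ≤ᵇ_) (toL a))
  where
  K : List Tm
  K = keep (b ≤ᵇ_) (toL a)

WF-+ω : ∀ a b → WF a → WF b → WF (a +ω b)
WF-+ω a b wa wb = let w , d = +ω-entries a b wa wb in WF-fromL (keep (b ≤ᵇ_) (toL a) ++ b ∷ []) w d

head≺ : ∀ a as → a ≺ ⟨ a ∷ as ⟩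
head≺ Ω _ = ≼-refl Ω
head≺ (ϑ a) _ = ≼-refl (ϑ a)
head≺ ⟨ [] ⟩ _ = tt
head≺ ⟨ b ∷ bs ⟩ as = T-∨⁺ˡ ((b ≡ᵗ ⟨ b ∷ bs ⟩) ∧ lex bs as) (head≺ b bs)

toL-≼ : ∀ x → WF x → All (_≼ x) (toL x)
toL-≼ Ω _ = ≼-refl Ω ∷ []
toL-≼ (ϑ a) _ = ≼-refl (ϑ a) ∷ []
toL-≼ ⟨ [] ⟩ _ = []
toL-≼ ⟨ a ∷ as ⟩ w =
  All-map (λ {e} e≼a → ≺⇒≼ e ⟨ a ∷ as ⟩ (≼-≺-trans e a ⟨ a ∷ as ⟩ e≼a (head≺ a as)))
    (descending⇒≼head a as (T-∧⁻ˡ (descending (a ∷ as)) (T-∧⁻ʳ (wfs (a ∷ as)) w)))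

mutual
  E-≼ : ∀ x → WF x → ∀ {e} → e ∈ E x → e ≼ x × WF e
  E-≼ Ω _ ()
  E-≼ (ϑ a) w (here refl) = ≼-refl (ϑ a) , w
  E-≼ ⟨ as ⟩ w m = Es-≼ ⟨ as ⟩ as (wfs⇒All as (T-∧⁻ˡ (wfs as) w)) (toL-≼ ⟨ as ⟩ w) m

  Es-≼ : ∀ x as → All WF as → All (_≼ x) as → ∀ {e} → e ∈ Es as → e ≼ x × WF e
  Es-≼ x [] _ _ ()
  Es-≼ x (a ∷ as) (wa ∷ ws) (a≼x ∷ as≼x) {e} m with ∈-++⁻ (E a) m
  ... | inj₁ m′ = let e≼a , we = E-≼ a wa m′ in ≼-trans e a x e≼a a≼x , we
  ... | inj₂ m′ = Es-≼ x as ws as≼x m′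

allE<⁺ : ∀ a y → (∀ {e} → e ∈ E a → e ≺ y) → T (allE< a y)
allE<⁺ Ω _ _ = tt
allE<⁺ (ϑ _) _ f = f (here refl)
allE<⁺ ⟨ as ⟩ y f = allEs<⁺ as y f
  where
  allEs<⁺ : ∀ as y → (∀ {e} → e ∈ Es as → e ≺ y) → T (allEs< as y)
  allEs<⁺ [] _ _ = tt
  allEs<⁺ (a ∷ as) y f = T-∧⁺ (allE<⁺ a y (λ m → f (∈-++⁺ˡ m))) (allEs<⁺ as y (λ m → f (∈-++⁺ʳ (E a) m)))

C-toL : ∀ {g d} a → WF a → C g d a → All (C g d) (toL a)
C-toL Ω _ _ = cΩ ∷ []
C-toL (ϑ _) _ c = c ∷ []
C-toL ⟨ _ ⟩ _ (c⟨⟩ cs _) = cs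
C-toL {g} {d} ⟨ as ⟩ w (c≺ _ as≺d) =
  below as (wfs⇒All as (T-∧⁻ˡ (wfs as) w)) (toL-≼ ⟨ as ⟩ w)
  where
  below : ∀ l → All WF l → All (_≼ ⟨ as ⟩) l → All (C g d) l
  below [] _ _ = []
  below (e ∷ l) (we ∷ ws) (e≼ ∷ ls) = c≺ we (≼-≺-trans e ⟨ as ⟩ d e≼ as≺d) ∷ below l ws ls

C-fromL : ∀ {g d} l → All (C g d) l → T (wfs l) → T (descending l) → C g d (fromL l)
C-fromL [] _ _ _ = c⟨⟩ [] tt
C-fromL (Ω ∷ []) _ _ _ = cΩ
C-fromL (ϑ _ ∷ []) (c ∷ []) _ _ = c
C-fromL l@(Ω ∷ _ ∷ _) cs w d = c⟨⟩ cs (WF-fromL l w d)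
C-fromL l@(ϑ _ ∷ _ ∷ _) cs w d = c⟨⟩ cs (WF-fromL l w d)
C-fromL l@(⟨ _ ⟩ ∷ _) cs w d = c⟨⟩ cs (WF-fromL l w d)

C-+ω : ∀ {g d} a b → WF a → WF b → C g d a → C g d b → C g d (a +ω b)
C-+ω a b wa wb ca cb with keep-prefix (b ≤ᵇ_) (toL a) | +ω-entries a b wa wb
... | M , e , _ | w , d =
  C-fromL (K ++ b ∷ []) (All.++⁺ (All.++⁻ˡ K (subst (All (C _ _)) e (C-toL a wa ca))) (cb ∷ [])) w d
  where
  K : List Tm
  K = keep (b ≤ᵇ_) (toL a)

mutual
  C-≺Ω⇒≺ϑ : ∀ h x → C h (ϑ h) x → x ≺ Ω → x ≺ ϑ h
  C-≺Ω⇒≺ϑ h x (c≺ _ x≺ϑh) _ = x≺ϑh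
  C-≺Ω⇒≺ϑ h (ϑ γ) (cϑ c γ≺h) _ = T-∨⁺ˡ (anyE≥ (ϑ γ) h) (T-∧⁺ γ≺h (C-allE<ϑ h γ c))
  C-≺Ω⇒≺ϑ h ⟨ [] ⟩ (c⟨⟩ _ _) _ = tt
  C-≺Ω⇒≺ϑ h ⟨ a ∷ _ ⟩ (c⟨⟩ (ca ∷ _) _) a≺Ω = C-≺Ω⇒≺ϑ h a ca a≺Ω

  C-allE<ϑ : ∀ h γ → C h (ϑ h) γ → T (allE< γ (ϑ h))
  C-allE<ϑ h Ω _ = tt
  C-allE<ϑ h (ϑ γ) c = C-≺Ω⇒≺ϑ h (ϑ γ) c tt
  C-allE<ϑ h ⟨ γs ⟩ (c≺ w γs≺ϑh) =
    allE<⁺ ⟨ γs ⟩ (ϑ h) (λ {e} m → ≼-≺-trans e ⟨ γs ⟩ (ϑ h) (proj₁ (E-≼ ⟨ γs ⟩ w m)) γs≺ϑh)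
  C-allE<ϑ h ⟨ γs ⟩ (c⟨⟩ cs _) = C-allEs<ϑ h γs cs

  C-allEs<ϑ : ∀ h γs → All (C h (ϑ h)) γs → T (allEs< γs (ϑ h))
  C-allEs<ϑ h [] _ = tt
  C-allEs<ϑ h (γ ∷ γs) (c ∷ cs) = T-∧⁺ (C-allE<ϑ h γ c) (C-allEs<ϑ h γs cs)

ϑ-mono : ∀ a b → a ≺ b → C b (ϑ b) a → ϑ a ≺ ϑ b
ϑ-mono a b a≺b c = T-∨⁺ˡ (anyE≥ (ϑ a) b) (T-∧⁺ a≺b (C-allE<ϑ b a c))

H-mono : ∀ a b {Y Z} → a ≼ b → Y ⊆ Z → H a Y ⊆ H b Z
H-mono a b a≼b Y⊆Z x (w , f) =
  w , λ γ δ wγ wδ b≺γ Z⊆C → f γ δ wγ wδ (≼-≺-trans a b γ a≼b b≺γ) (λ y y∈Y → Z⊆C y (Y⊆Z y y∈Y))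

H-monoʳ : ∀ a {Y Z x} → Y ⊆ Z → H a Y x → H a Z x
H-monoʳ a Y⊆Z = H-mono a a (≼-refl a) Y⊆Z _

H-monoˡ : ∀ a b {Y x} → a ≼ b → H a Y x → H b Y x
H-monoˡ a b a≼b = H-mono a b a≼b (λ _ y → y) _

H-∪∅⁻ : ∀ a {Y x} → H a (Y ∪ ∅) x → H a Y x
H-∪∅⁻ a = H-monoʳ a (λ { _ (inj₁ y) → y ; _ (inj₂ ()) })

H-∪∅⁺ : ∀ a {Y x} → H a Y x → H a (Y ∪ ∅) x
H-∪∅⁺ a = H-monoʳ a (λ _ → inj₁)

H⊆C : ∀ {Y x} a g d → H a Y x → a ≺ g → WF g → WF d → Y ⊆ C g d → C g d x
H⊆C a g d (_ , f) a≺g wg wd Y⊆C = f g d wg wd a≺g Y⊆C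

H-+ω : ∀ c a b {Y} → H c Y a → H c Y b → H c Y (a +ω b)
H-+ω c a b ha hb =
  WF-+ω a b (proj₁ ha) (proj₁ hb) ,
  λ γ δ wγ wδ c≺γ Y⊆C → C-+ω a b (proj₁ ha) (proj₁ hb) (H⊆C c γ δ ha c≺γ wγ wδ Y⊆C) (H⊆C c γ δ hb c≺γ wγ wδ Y⊆C)

H-ϑ : ∀ c x {Y} → H c Y x → x ≼ c → H c Y (ϑ x)
H-ϑ c x (w , f) x≼c = w , λ γ δ wγ wδ c≺γ Y⊆C → cϑ (f γ δ wγ wδ c≺γ Y⊆C) (≼-≺-trans x c γ x≼c c≺γ)

k-neg : ∀ {n} (ψ : Fm n) → k (neg ψ) ≡ k ψ
k-neg (_ ≐ _) = refl
k-neg (_ ≠̇ _) = refl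
k-neg (I _ _ _) = refl
k-neg (¬I _ _ _) = refl
k-neg (ψ ∧̇ χ) = cong₂ _++_ (k-neg ψ) (k-neg χ)
k-neg (ψ ∨̇ χ) = cong₂ _++_ (k-neg ψ) (k-neg χ)
k-neg (∀̇ ψ) = k-neg ψ
k-neg (∃̇ ψ) = k-neg ψ

k-substF : ∀ {m n} (σ : Fin m → ATm n) ψ → k (substF σ ψ) ≡ k ψ
k-substF σ (_ ≐ _) = refl
k-substF σ (_ ≠̇ _) = refl
k-substF σ (I _ _ _) = refl
k-substF σ (¬I _ _ _) = refl
k-substF σ (ψ ∧̇ χ) = cong₂ _++_ (k-substF σ ψ) (k-substF σ χ)
k-substF σ (ψ ∨̇ χ) = cong₂ _++_ (k-substF σ ψ) (k-substF σ χ)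
k-substF σ (∀̇ ψ) = k-substF (exts σ) ψ
k-substF σ (∃̇ ψ) = k-substF (exts σ) ψ

k-instOF : ∀ {m n} φ γ (σ : Fin m → ATm n) χ → All (_≡ γ) (k (instOF φ γ σ χ))
k-instOF φ γ σ (_ ≐ _) = []
k-instOF φ γ σ (_ ≠̇ _) = []
k-instOF φ γ σ (X _) = refl ∷ []
k-instOF φ γ σ (ψ ∧̇ χ) = All.++⁺ (k-instOF φ γ σ ψ) (k-instOF φ γ σ χ)
k-instOF φ γ σ (ψ ∨̇ χ) = All.++⁺ (k-instOF φ γ σ ψ) (k-instOF φ γ σ χ)
k-instOF φ γ σ (∀̇ ψ) = k-instOF φ γ (exts σ) ψ
k-instOF φ γ σ (∃̇ ψ) = k-instOF φ γ (exts σ) ψ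

NoNegIΩ-substF : ∀ {m n} (σ : Fin m → ATm n) ψ → NoNegIΩ ψ → NoNegIΩ (substF σ ψ)
NoNegIΩ-substF σ (_ ≐ _) _ = tt
NoNegIΩ-substF σ (_ ≠̇ _) _ = tt
NoNegIΩ-substF σ (I _ _ _) _ = tt
NoNegIΩ-substF σ (¬I _ _ _) h = h
NoNegIΩ-substF σ (ψ ∧̇ χ) (h , h′) = NoNegIΩ-substF σ ψ h , NoNegIΩ-substF σ χ h′
NoNegIΩ-substF σ (ψ ∨̇ χ) (h , h′) = NoNegIΩ-substF σ ψ h , NoNegIΩ-substF σ χ h′
NoNegIΩ-substF σ (∀̇ ψ) h = NoNegIΩ-substF (exts σ) ψ h
NoNegIΩ-substF σ (∃̇ ψ) h = NoNegIΩ-substF (exts σ) ψ h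

NoNegIΩ-instOF : ∀ {m n} φ γ (σ : Fin m → ATm n) χ → NoNegIΩ (instOF φ γ σ χ)
NoNegIΩ-instOF φ γ σ (_ ≐ _) = tt
NoNegIΩ-instOF φ γ σ (_ ≠̇ _) = tt
NoNegIΩ-instOF φ γ σ (X _) = tt
NoNegIΩ-instOF φ γ σ (ψ ∧̇ χ) = NoNegIΩ-instOF φ γ σ ψ , NoNegIΩ-instOF φ γ σ χ
NoNegIΩ-instOF φ γ σ (ψ ∨̇ χ) = NoNegIΩ-instOF φ γ σ ψ , NoNegIΩ-instOF φ γ σ χ
NoNegIΩ-instOF φ γ σ (∀̇ ψ) = NoNegIΩ-instOF φ γ (exts σ) ψ
NoNegIΩ-instOF φ γ σ (∃̇ ψ) = NoNegIΩ-instOF φ γ (exts σ) ψ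

NoNegIΩ-neg-instOF : ∀ {m n} φ γ (σ : Fin m → ATm n) χ → γ ≢ Ω → NoNegIΩ (neg (instOF φ γ σ χ))
NoNegIΩ-neg-instOF φ γ σ (_ ≐ _) _ = tt
NoNegIΩ-neg-instOF φ γ σ (_ ≠̇ _) _ = tt
NoNegIΩ-neg-instOF φ γ σ (X _) γ≢Ω = γ≢Ω
NoNegIΩ-neg-instOF φ γ σ (ψ ∧̇ χ) γ≢Ω = NoNegIΩ-neg-instOF φ γ σ ψ γ≢Ω , NoNegIΩ-neg-instOF φ γ σ χ γ≢Ω
NoNegIΩ-neg-instOF φ γ σ (ψ ∨̇ χ) γ≢Ω = NoNegIΩ-neg-instOF φ γ σ ψ γ≢Ω , NoNegIΩ-neg-instOF φ γ σ χ γ≢Ω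
NoNegIΩ-neg-instOF φ γ σ (∀̇ ψ) γ≢Ω = NoNegIΩ-neg-instOF φ γ (exts σ) ψ γ≢Ω
NoNegIΩ-neg-instOF φ γ σ (∃̇ ψ) γ≢Ω = NoNegIΩ-neg-instOF φ γ (exts σ) ψ γ≢Ω

Ω∉k⇒NoNegIΩ : ∀ {n} (ψ : Fm n) → All (_≢ Ω) (k ψ) → NoNegIΩ ψ × NoNegIΩ (neg ψ)
Ω∉k⇒NoNegIΩ (_ ≐ _) _ = tt , tt
Ω∉k⇒NoNegIΩ (_ ≠̇ _) _ = tt , tt
Ω∉k⇒NoNegIΩ (I _ _ _) (a≢Ω ∷ []) = tt , a≢Ω
Ω∉k⇒NoNegIΩ (¬I _ _ _) (a≢Ω ∷ []) = a≢Ω , tt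
Ω∉k⇒NoNegIΩ (ψ ∧̇ χ) h =
  let hψ , hχ = All.++⁻ (k ψ) h ; pψ , nψ = Ω∉k⇒NoNegIΩ ψ hψ ; pχ , nχ = Ω∉k⇒NoNegIΩ χ hχ
  in (pψ , pχ) , (nψ , nχ)
Ω∉k⇒NoNegIΩ (ψ ∨̇ χ) h =
  let hψ , hχ = All.++⁻ (k ψ) h ; pψ , nψ = Ω∉k⇒NoNegIΩ ψ hψ ; pχ , nχ = Ω∉k⇒NoNegIΩ χ hχ
  in (pψ , pχ) , (nψ , nχ)
Ω∉k⇒NoNegIΩ (∀̇ ψ) h = Ω∉k⇒NoNegIΩ ψ h
Ω∉k⇒NoNegIΩ (∃̇ ψ) h = Ω∉k⇒NoNegIΩ ψ h

Ω∈⊎All≢Ω : ∀ l → Ω ∈ l ⊎ All (_≢ Ω) l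
Ω∈⊎All≢Ω [] = inj₂ []
Ω∈⊎All≢Ω (a ∷ l) with a ≡ᵗ Ω in e
... | true = inj₁ (here (sym (≡ᵗ⇒≡ a Ω (subst T (sym e) tt))))
... | false with Ω∈⊎All≢Ω l
...   | inj₁ m = inj₁ (there m)
...   | inj₂ h = inj₂ ((λ { refl → ≡false⇒¬T e tt }) ∷ h)

ΣΩ-Sentence : Sentence → Set
ΣΩ-Sentence ψ = IsSentence ψ × NoNegIΩ ψ

≼Ω∧≢Ω⇒≺Ω : ∀ a → a ≼ Ω → a ≢ Ω → a ≺ Ω
≼Ω∧≢Ω⇒≺Ω a a≼Ω a≢Ω with ≼⇒≺⊎≡ a Ω a≼Ω
... | inj₁ a≺Ω = a≺Ω
... | inj₂ a≡Ω = ⊥-elim (a≢Ω a≡Ω)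

≺Ω⇒≢Ω : ∀ a → a ≺ Ω → a ≢ Ω
≺Ω⇒≢Ω .Ω () refl

ΣΩ-instOF : ∀ φ γ t → WF γ → γ ≼ Ω → ΣΩ-Sentence (φ ⟦ t ,I≺ γ ⟧)
ΣΩ-instOF φ γ t wγ γ≼Ω =
  All-map (λ { refl → wγ , γ≼Ω }) (k-instOF φ γ (λ _ → t) φ) , NoNegIΩ-instOF φ γ (λ _ → t) φ

ΣΩ-neg-instOF : ∀ φ γ t → WF γ → γ ≺ Ω → ΣΩ-Sentence (neg (φ ⟦ t ,I≺ γ ⟧))
ΣΩ-neg-instOF φ γ t wγ γ≺Ω =
  subst (All (λ a → WF a × a ≼ Ω)) (sym (k-neg (φ ⟦ t ,I≺ γ ⟧)))
    (All-map (λ { refl → wγ , ≺⇒≼ γ Ω γ≺Ω }) (k-instOF φ γ (λ _ → t) φ)) ,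
  NoNegIΩ-neg-instOF φ γ (λ _ → t) φ (≺Ω⇒≢Ω γ γ≺Ω)

ΣΩ-neg : ∀ ψ → IsSentence ψ → All (_≢ Ω) (k ψ) → ΣΩ-Sentence ψ × ΣΩ-Sentence (neg ψ)
ΣΩ-neg ψ sψ Ω∉ =
  let pψ , nψ = Ω∉k⇒NoNegIΩ ψ Ω∉ in
  (sψ , pψ) , (subst (All (λ a → WF a × a ≼ Ω)) (sym (k-neg ψ)) sψ , nψ)

pick2-elim : ∀ (P : Sentence → Set) ψ χ γ → P ψ → P χ → P (pick2 ψ χ γ)
pick2-elim P ψ χ γ pψ pχ with γ ≡ᵗ zeroᵗ
... | true = pψ
... | false = pχ

arity : Junction → Tm
arity (⋁ δ _) = δ
arity (⋀ δ _) = δ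

JunctionOf : Sentence → Tm → (Tm → Sentence) → Set
JunctionOf ψ δ f = junction ψ ≡ ⋀ δ f ⊎ junction ψ ≡ ⋁ δ f

≺arity : ∀ ψ {δ f} γ → JunctionOf ψ δ f → γ ≺ δ → γ ≺ arity (junction ψ)
≺arity _ _ (inj₁ j) γ≺δ rewrite j = γ≺δ
≺arity _ _ (inj₂ j) γ≺δ rewrite j = γ≺δ

≮arity-≐ : ∀ s t γ → γ ≺ arity (junction (s ≐ t)) → ⊥
≮arity-≐ s t γ with evalA s ≡ᵇ evalA t
... | true = ≮zero γ
... | false = ≮zero γ

≮arity-≠̇ : ∀ s t γ → γ ≺ arity (junction (s ≠̇ t)) → ⊥
≮arity-≠̇ s t γ with evalA s ≡ᵇ evalA t
... | true = ≮zero γ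
... | false = ≮zero γ

ΣΩ-substF : ∀ (σ : Fin 1 → ATm 0) ψ → IsSentence (∀̇ ψ) → NoNegIΩ ψ → ΣΩ-Sentence (substF σ ψ)
ΣΩ-substF σ ψ sψ nψ = subst (All (λ a → WF a × a ≼ Ω)) (sym (k-substF σ ψ)) sψ , NoNegIΩ-substF σ ψ nψ

ΣΩ-premise : ∀ ψ {δ f γ} → ΣΩ-Sentence ψ → JunctionOf ψ δ f → WF γ → γ ≺ δ → ΣΩ-Sentence (f γ)
ΣΩ-premise (s ≐ t) {γ = γ} _ j _ γ≺δ = ⊥-elim (≮arity-≐ s t γ (≺arity (s ≐ t) γ j γ≺δ))
ΣΩ-premise (s ≠̇ t) {γ = γ} _ j _ γ≺δ = ⊥-elim (≮arity-≠̇ s t γ (≺arity (s ≠̇ t) γ j γ≺δ))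
ΣΩ-premise (I a φ t) {γ = γ} ((_ , a≼Ω) ∷ [] , _) (inj₂ refl) wγ γ≺a =
  ΣΩ-instOF φ γ t wγ (≺⇒≼ γ Ω (≺-≼-trans γ a Ω γ≺a a≼Ω))
ΣΩ-premise (¬I a φ t) {γ = γ} ((_ , a≼Ω) ∷ [] , a≢Ω) (inj₁ refl) wγ γ≺a =
  ΣΩ-neg-instOF φ γ t wγ (≺-trans γ a Ω γ≺a (≼Ω∧≢Ω⇒≺Ω a a≼Ω a≢Ω))
ΣΩ-premise (ψ ∧̇ χ) {γ = γ} (s , nψ , nχ) (inj₁ refl) _ _ =
  let sψ , sχ = All.++⁻ (k ψ) s in pick2-elim ΣΩ-Sentence ψ χ γ (sψ , nψ) (sχ , nχ)
ΣΩ-premise (ψ ∨̇ χ) {γ = γ} (s , nψ , nχ) (inj₂ refl) _ _ =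
  let sψ , sχ = All.++⁻ (k ψ) s in pick2-elim ΣΩ-Sentence ψ χ γ (sψ , nψ) (sχ , nχ)
ΣΩ-premise (∀̇ ψ) {γ = γ} (s , n) (inj₁ refl) _ _ = ΣΩ-substF (λ _ → numA (toℕᵗ γ)) ψ s n
ΣΩ-premise (∃̇ ψ) {γ = γ} (s , n) (inj₂ refl) _ _ = ΣΩ-substF (λ _ → numA (toℕᵗ γ)) ψ s n

⋁-index≺Ω : ∀ ψ {δ f γ} → IsSentence ψ → junction ψ ≡ ⋁ δ f → γ ≺ δ → γ ≺ Ω
⋁-index≺Ω (s ≐ t) {γ = γ} _ j γ≺δ = ⊥-elim (≮arity-≐ s t γ (≺arity (s ≐ t) γ (inj₂ j) γ≺δ))
⋁-index≺Ω (s ≠̇ t) {γ = γ} _ j γ≺δ = ⊥-elim (≮arity-≠̇ s t γ (≺arity (s ≠̇ t) γ (inj₂ j) γ≺δ))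
⋁-index≺Ω (I a _ _) {γ = γ} ((_ , a≼Ω) ∷ []) refl γ≺a = ≺-≼-trans γ a Ω γ≺a a≼Ω
⋁-index≺Ω (_ ∨̇ _) {γ = γ} _ refl γ≺2 = ≺-trans γ (numᵗ 2) Ω γ≺2 tt
⋁-index≺Ω (∃̇ _) {γ = γ} _ refl γ≺ω = ≺-trans γ ωᵗ Ω γ≺ω tt

⋀-index-bound : ∀ ψ {δ f γ} → ΣΩ-Sentence ψ → junction ψ ≡ ⋀ δ f → γ ≺ δ →
  γ ≺ ωᵗ ⊎ Σ Tm (λ a → a ∈ k ψ × a ≺ Ω × γ ≺ a)
⋀-index-bound (s ≐ t) {γ = γ} _ j γ≺δ = ⊥-elim (≮arity-≐ s t γ (≺arity (s ≐ t) γ (inj₁ j) γ≺δ))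
⋀-index-bound (s ≠̇ t) {γ = γ} _ j γ≺δ = ⊥-elim (≮arity-≠̇ s t γ (≺arity (s ≠̇ t) γ (inj₁ j) γ≺δ))
⋀-index-bound (¬I a _ _) ((_ , a≼Ω) ∷ [] , a≢Ω) refl γ≺a = inj₂ (a , here refl , ≼Ω∧≢Ω⇒≺Ω a a≼Ω a≢Ω , γ≺a)
⋀-index-bound (_ ∧̇ _) {γ = γ} _ refl γ≺2 = inj₁ (≺-trans γ (numᵗ 2) ωᵗ γ≺2 tt)
⋀-index-bound (∀̇ _) _ refl γ≺ω = inj₁ γ≺ω

maxᵗ-elim : ∀ (P : Tm → Set) a b → P a → P b → P (maxᵗ a b)
maxᵗ-elim P a b pa pb with a ≤ᵇ b
... | true = pb
... | false = pa

head-≺ϑ : ∀ x h b₀ bs → x ≺ ϑ h → toL x ≡ b₀ ∷ bs → b₀ ≺ ϑ h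
head-≺ϑ (ϑ _) _ _ _ p refl = p
head-≺ϑ ⟨ _ ∷ _ ⟩ _ _ _ p refl = p

+ᵗ-∷-≺ϑ : ∀ x y b₀ bs h → toL y ≡ b₀ ∷ bs → x ≺ ϑ h → b₀ ≺ ϑ h → (x +ᵗ y) ≺ ϑ h
+ᵗ-∷-≺ϑ x y b₀ bs h e x≺ϑh b₀≺ϑh rewrite +ᵗ-∷ x y b₀ bs e with keep-prefix (b₀ ≤ᵇ_) (toL x)
... | M , toLx≡ , _ =
  lex⇒fromL≺fromL (keep (b₀ ≤ᵇ_) (toL x) ++ b₀ ∷ bs) (ϑ h ∷ []) (head-below _ toLx≡)
  where
  head-below : ∀ K → toL x ≡ K ++ M → T (lex (K ++ b₀ ∷ bs) (ϑ h ∷ []))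
  head-below [] _ = T-∨⁺ˡ ((b₀ ≡ᵗ ϑ h) ∧ lex bs []) b₀≺ϑh
  head-below (k₀ ∷ K) e′ = T-∨⁺ˡ ((k₀ ≡ᵗ ϑ h) ∧ lex (K ++ b₀ ∷ bs) []) (head-≺ϑ x h k₀ (K ++ M) x≺ϑh e′)

+ᵗ-≺ϑ : ∀ x y h → x ≺ ϑ h → y ≺ ϑ h → (x +ᵗ y) ≺ ϑ h
+ᵗ-≺ϑ x (ϑ b) h x≺ϑh y≺ϑh = +ᵗ-∷-≺ϑ x (ϑ b) (ϑ b) [] h refl x≺ϑh y≺ϑh
+ᵗ-≺ϑ x ⟨ [] ⟩ h x≺ϑh _ = x≺ϑh
+ᵗ-≺ϑ x ⟨ b ∷ bs ⟩ h x≺ϑh b≺ϑh = +ᵗ-∷-≺ϑ x ⟨ b ∷ bs ⟩ b bs h refl x≺ϑh b≺ϑh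

ω·-≺ϑ : ∀ a h → a ≺ ϑ h → (ω· a) ≺ ϑ h
ω·-≺ϑ (ϑ _) _ p = p
ω·-≺ϑ ⟨ [] ⟩ _ _ = tt
ω·-≺ϑ ⟨ a ∷ _ ⟩ h p = +ᵗ-≺ϑ (numᵗ 1) a h tt p

mutual
  rk-≺ϑ : ∀ {n} (ψ : Fm n) h → All (_≺ ϑ h) (k ψ) → rk ψ ≺ ϑ h
  rk-≺ϑ (_ ≐ _) _ _ = tt
  rk-≺ϑ (_ ≠̇ _) _ _ = tt
  rk-≺ϑ (I a _ _) h (p ∷ []) = ω·-≺ϑ a h p
  rk-≺ϑ (¬I a _ _) h (p ∷ []) = ω·-≺ϑ a h p
  rk-≺ϑ (ψ ∧̇ χ) h ps = +ᵗ-≺ϑ (maxᵗ (rk ψ) (rk χ)) (numᵗ 1) h (rk-max-≺ϑ ψ χ h ps) tt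
  rk-≺ϑ (ψ ∨̇ χ) h ps = +ᵗ-≺ϑ (maxᵗ (rk ψ) (rk χ)) (numᵗ 1) h (rk-max-≺ϑ ψ χ h ps) tt
  rk-≺ϑ (∀̇ ψ) h ps = +ᵗ-≺ϑ (rk ψ) (numᵗ 1) h (rk-≺ϑ ψ h ps) tt
  rk-≺ϑ (∃̇ ψ) h ps = +ᵗ-≺ϑ (rk ψ) (numᵗ 1) h (rk-≺ϑ ψ h ps) tt

  rk-max-≺ϑ : ∀ {n} (ψ χ : Fm n) h → All (_≺ ϑ h) (k ψ ++ k χ) → maxᵗ (rk ψ) (rk χ) ≺ ϑ h
  rk-max-≺ϑ ψ χ h ps =
    let pψ , pχ = All.++⁻ (k ψ) ps in maxᵗ-elim (_≺ ϑ h) (rk ψ) (rk χ) (rk-≺ϑ ψ h pψ) (rk-≺ϑ χ h pχ)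

-- Formulas mentioning I^{≺Ω} have rank ≽ Ω, so such a formula has rank ≺ Ω+1 only if it is a literal.
+1≡∷ʳzero : ∀ m → m +ᵗ numᵗ 1 ≡ fromL (toL m ++ zeroᵗ ∷ [])
+1≡∷ʳzero m =
  trans (+ᵗωf≡+ω m zeroᵗ)
        (cong (λ l → fromL (l ++ zeroᵗ ∷ [])) (keep-all (zeroᵗ ≤ᵇ_) (toL m) (universal zero≼ (toL m))))
  where
  zero≼ : ∀ x → zeroᵗ ≼ x
  zero≼ Ω = tt
  zero≼ (ϑ _) = tt
  zero≼ ⟨ [] ⟩ = tt
  zero≼ ⟨ _ ∷ _ ⟩ = tt

≺+1 : ∀ m → m ≺ (m +ᵗ numᵗ 1)
≺+1 m = subst (m ≺_) (sym (+ᵗωf≡+ω m zeroᵗ)) (+ω-increasing m zeroᵗ)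

Ω≼-+1 : ∀ m → Ω ≼ m → Ω ≼ (m +ᵗ numᵗ 1)
Ω≼-+1 m Ω≼m = ≺⇒≼ Ω (m +ᵗ numᵗ 1) (≼-≺-trans Ω m (m +ᵗ numᵗ 1) Ω≼m (≺+1 m))

Ω≼maxᵗ : ∀ a b → Ω ≼ a ⊎ Ω ≼ b → Ω ≼ maxᵗ a b
Ω≼maxᵗ a b Ω≼ with a ≤ᵇ b in a≤b
Ω≼maxᵗ a b (inj₁ Ω≼a) | true = ≼-trans Ω a b Ω≼a (subst T (sym a≤b) tt)
Ω≼maxᵗ a b (inj₂ Ω≼b) | true = Ω≼b
Ω≼maxᵗ a b (inj₁ Ω≼a) | false = Ω≼a
Ω≼maxᵗ a b (inj₂ Ω≼b) | false with ≺-trichotomy a Ω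
... | inj₁ a≺Ω = ⊥-elim (≡false⇒¬T a≤b (≺⇒≼ a b (≺-≼-trans a Ω b a≺Ω Ω≼b)))
... | inj₂ (inj₁ refl) = ≼-refl Ω
... | inj₂ (inj₂ Ω≺a) = ≺⇒≼ Ω a Ω≺a

mutual
  Ω∈k⇒Ω≼rk : ∀ {n} (ψ : Fm n) → Ω ∈ k ψ → Ω ≼ rk ψ
  Ω∈k⇒Ω≼rk (I .Ω _ _) (here refl) = ≼-refl Ω
  Ω∈k⇒Ω≼rk (¬I .Ω _ _) (here refl) = ≼-refl Ω
  Ω∈k⇒Ω≼rk (ψ ∧̇ χ) m = Ω≼-+1 (maxᵗ (rk ψ) (rk χ)) (Ω∈k⇒Ω≼rk-max ψ χ m)
  Ω∈k⇒Ω≼rk (ψ ∨̇ χ) m = Ω≼-+1 (maxᵗ (rk ψ) (rk χ)) (Ω∈k⇒Ω≼rk-max ψ χ m)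
  Ω∈k⇒Ω≼rk (∀̇ ψ) m = Ω≼-+1 (rk ψ) (Ω∈k⇒Ω≼rk ψ m)
  Ω∈k⇒Ω≼rk (∃̇ ψ) m = Ω≼-+1 (rk ψ) (Ω∈k⇒Ω≼rk ψ m)

  Ω∈k⇒Ω≼rk-max : ∀ {n} (ψ χ : Fm n) → Ω ∈ k ψ ++ k χ → Ω ≼ maxᵗ (rk ψ) (rk χ)
  Ω∈k⇒Ω≼rk-max ψ χ m with ∈-++⁻ (k ψ) m
  ... | inj₁ m′ = Ω≼maxᵗ (rk ψ) (rk χ) (inj₁ (Ω∈k⇒Ω≼rk ψ m′))
  ... | inj₂ m′ = Ω≼maxᵗ (rk ψ) (rk χ) (inj₂ (Ω∈k⇒Ω≼rk χ m′))

fromL-∷-∷ʳ : ∀ b bs c → fromL (b ∷ bs ++ c ∷ []) ≡ ⟨ b ∷ bs ++ c ∷ [] ⟩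
fromL-∷-∷ʳ b bs c = long b (bs ++ c ∷ []) (∷ʳ-nonempty bs)
  where
  ∷ʳ-nonempty : ∀ bs → Σ Tm λ d → Σ (List Tm) λ l → bs ++ c ∷ [] ≡ d ∷ l
  ∷ʳ-nonempty [] = c , [] , refl
  ∷ʳ-nonempty (d ∷ l) = d , l ++ c ∷ [] , refl
  long : ∀ b r → Σ Tm (λ d → Σ (List Tm) λ l → r ≡ d ∷ l) → fromL (b ∷ r) ≡ ⟨ b ∷ r ⟩
  long Ω _ (_ , _ , refl) = refl
  long (ϑ _) _ (_ , _ , refl) = refl
  long ⟨ _ ⟩ _ (_ , _ , refl) = refl

Ω≼⇒+1⊀Ω+1 : ∀ m → Ω ≼ m → (m +ᵗ numᵗ 1) ≺ (Ω +ᵗ numᵗ 1) → ⊥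
Ω≼⇒+1⊀Ω+1 m Ω≼m rewrite +1≡∷ʳzero m = go m Ω≼m
  where
  tail⊀ : ∀ bs → T (lex (bs ++ zeroᵗ ∷ []) (zeroᵗ ∷ [])) → ⊥
  tail⊀ [] ()
  tail⊀ (c ∷ bs) p =
    T-∨-case (c <ᵇ zeroᵗ) p (≮zero c) (λ e → lex-≮[] (bs ++ zeroᵗ ∷ []) (T-∧⁻ʳ (c ≡ᵗ zeroᵗ) e))
  go : ∀ m → Ω ≼ m → fromL (toL m ++ zeroᵗ ∷ []) ≺ ⟨ Ω ∷ zeroᵗ ∷ [] ⟩ → ⊥
  go Ω _ ()
  go ⟨ b ∷ bs ⟩ Ω≼m p rewrite fromL-∷-∷ʳ b bs zeroᵗ =
    T-∨-case (b <ᵇ Ω) p (≼-≺-trans Ω b Ω Ω≼b) (λ e → tail⊀ bs (T-∧⁻ʳ (b ≡ᵗ Ω) e))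
    where
    Ω≼b : Ω ≼ b
    Ω≼b = T-∨-case (Ω <ᵇ ⟨ b ∷ bs ⟩) Ω≼m (λ Ω≺m → Ω≺m) (λ ())

rk≺Ω+1⇒Ω-literal : ∀ (ψ : Sentence) → rk ψ ≺ (Ω +ᵗ numᵗ 1) → Ω ∈ k ψ →
  Σ (OF 1) λ φ → Σ (ATm 0) λ t → ψ ≡ I Ω φ t ⊎ ψ ≡ ¬I Ω φ t
rk≺Ω+1⇒Ω-literal (I .Ω φ t) _ (here refl) = φ , t , inj₁ refl
rk≺Ω+1⇒Ω-literal (¬I .Ω φ t) _ (here refl) = φ , t , inj₂ refl
rk≺Ω+1⇒Ω-literal (ψ ∧̇ χ) r m = ⊥-elim (Ω≼⇒+1⊀Ω+1 (maxᵗ (rk ψ) (rk χ)) (Ω∈k⇒Ω≼rk-max ψ χ m) r)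
rk≺Ω+1⇒Ω-literal (ψ ∨̇ χ) r m = ⊥-elim (Ω≼⇒+1⊀Ω+1 (maxᵗ (rk ψ) (rk χ)) (Ω∈k⇒Ω≼rk-max ψ χ m) r)
rk≺Ω+1⇒Ω-literal (∀̇ ψ) r m = ⊥-elim (Ω≼⇒+1⊀Ω+1 (rk ψ) (Ω∈k⇒Ω≼rk ψ m) r)
rk≺Ω+1⇒Ω-literal (∃̇ ψ) r m = ⊥-elim (Ω≼⇒+1⊀Ω+1 (rk ψ) (Ω∈k⇒Ω≼rk ψ m) r)

side : ∀ {𝓗 a ρ Γ} → 𝓗 ⊢[ a , ρ ] Γ → Side 𝓗 a Γ
side (⋀-rule s _ _ _) = s
side (⋁-rule s _ _ _ _ _ _ _ _) = s
side (cut _ s _ _ _ _ _) = s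
side (fix s _ _ _ _) = s

Controlled : Op → List Sentence → Set
Controlled 𝓗 Γ = ∀ {ψ} → ψ ∈ Γ → All (𝓗 ∅) (k ψ)

Monotone : Op → Set₁
Monotone 𝓗 = ∀ {Y Z} → Y ⊆ Z → 𝓗 Y ⊆ 𝓗 Z

Monotone-[] : ∀ {𝓗} W → Monotone 𝓗 → Monotone (𝓗 [ W ])
Monotone-[] W mono Y⊆Z = mono (λ { x (inj₁ w) → inj₁ w ; x (inj₂ y) → inj₂ (Y⊆Z x y) })

∅⊆ : ∀ {Y} → ∅ ⊆ Y
∅⊆ _ ()

⊢-weaken : ∀ {𝓗 𝓗′ a a′ ρ ρ′ Γ} → 𝓗 ⊢[ a , ρ ] Γ → (∀ Y → 𝓗 Y ⊆ 𝓗′ Y) →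
  ρ ≼ ρ′ → a ≼ a′ → 𝓗′ ∅ a′ → 𝓗′ ⊢[ a′ , ρ′ ] Γ
⊢-weaken {a = a} {a′} (⋀-rule (_ , ks) m j premises) inc ρ≼ a≼ ha′ =
  ⋀-rule (ha′ , λ m′ → All-map (inc ∅ _) (ks m′)) m j
    (λ γ wγ γ≺δ → let a₀ , a₀≺a , d = premises γ wγ γ≺δ in
      a₀ , ≺-≼-trans a₀ a a′ a₀≺a a≼ ,
      ⊢-weaken d (λ Y → inc (｛ γ ｝ ∪ Y)) ρ≼ (≼-refl a₀) (inc _ a₀ (proj₁ (side d))))
⊢-weaken {a = a} {a′} (⋁-rule {γ = γ} {α′ = a₀} (_ , ks) m j wγ γ≺δ γ≺a hγ a₀≺a d) inc ρ≼ a≼ ha′ =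
  ⋁-rule (ha′ , λ m′ → All-map (inc ∅ _) (ks m′)) m j wγ γ≺δ (≺-≼-trans γ a a′ γ≺a a≼) (inc ∅ γ hγ)
    (≺-≼-trans a₀ a a′ a₀≺a a≼) (⊢-weaken d inc ρ≼ (≼-refl a₀) (inc ∅ a₀ (proj₁ (side d))))
⊢-weaken {a = a} {a′} {ρ} {ρ′} (cut {α′ = a₀} ψ (_ , ks) sψ rk≺ρ a₀≺a d₁ d₂) inc ρ≼ a≼ ha′ =
  cut ψ (ha′ , λ m′ → All-map (inc ∅ _) (ks m′)) sψ (≺-≼-trans (rk ψ) ρ ρ′ rk≺ρ ρ≼) (≺-≼-trans a₀ a a′ a₀≺a a≼)
    (⊢-weaken d₁ inc ρ≼ (≼-refl a₀) (inc ∅ a₀ (proj₁ (side d₁))))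
    (⊢-weaken d₂ inc ρ≼ (≼-refl a₀) (inc ∅ a₀ (proj₁ (side d₂))))
⊢-weaken {a = a} {a′} (fix {α′ = a₀} (_ , ks) Ω≼a m a₀≺a d) inc ρ≼ a≼ ha′ =
  fix (ha′ , λ m′ → All-map (inc ∅ _) (ks m′)) (≼-trans Ω a a′ Ω≼a a≼) m (≺-≼-trans a₀ a a′ a₀≺a a≼)
    (⊢-weaken d inc ρ≼ (≼-refl a₀) (inc ∅ a₀ (proj₁ (side d))))

⊢-mono : ∀ {𝓗 𝓗′ a ρ Γ} → 𝓗 ⊢[ a , ρ ] Γ → (∀ Y → 𝓗 Y ⊆ 𝓗′ Y) → 𝓗′ ⊢[ a , ρ ] Γ
⊢-mono {a = a} {ρ} d inc = ⊢-weaken d inc (≼-refl ρ) (≼-refl a) (inc ∅ a (proj₁ (side d)))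

data Lowered (l : Tm) : ∀ {n} → Fm n → Fm n → Set where
  same   : ∀ {n} {ψ : Fm n} → Lowered l ψ ψ
  lowerI : ∀ {n} {φ} {t : ATm n} → Lowered l (I Ω φ t) (I l φ t)
  _∧ᴸ_   : ∀ {n} {ψ ψ′ χ χ′ : Fm n} → Lowered l ψ ψ′ → Lowered l χ χ′ → Lowered l (ψ ∧̇ χ) (ψ′ ∧̇ χ′)
  _∨ᴸ_   : ∀ {n} {ψ ψ′ χ χ′ : Fm n} → Lowered l ψ ψ′ → Lowered l χ χ′ → Lowered l (ψ ∨̇ χ) (ψ′ ∨̇ χ′)
  ∀ᴸ     : ∀ {n} {ψ ψ′ : Fm (suc n)} → Lowered l ψ ψ′ → Lowered l (∀̇ ψ) (∀̇ ψ′)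
  ∃ᴸ     : ∀ {n} {ψ ψ′ : Fm (suc n)} → Lowered l ψ ψ′ → Lowered l (∃̇ ψ) (∃̇ ψ′)

Lowered-substF : ∀ {l m n} (σ : Fin m → ATm n) {ψ ψ′} → Lowered l ψ ψ′ → Lowered l (substF σ ψ) (substF σ ψ′)
Lowered-substF σ same = same
Lowered-substF σ lowerI = lowerI
Lowered-substF σ (L₁ ∧ᴸ L₂) = Lowered-substF σ L₁ ∧ᴸ Lowered-substF σ L₂
Lowered-substF σ (L₁ ∨ᴸ L₂) = Lowered-substF σ L₁ ∨ᴸ Lowered-substF σ L₂
Lowered-substF σ (∀ᴸ L) = ∀ᴸ (Lowered-substF (exts σ) L)
Lowered-substF σ (∃ᴸ L) = ∃ᴸ (Lowered-substF (exts σ) L)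

Lowered-instOF : ∀ {l m n} φ (σ : Fin m → ATm n) χ → Lowered l (instOF φ Ω σ χ) (instOF φ l σ χ)
Lowered-instOF φ σ (_ ≐ _) = same
Lowered-instOF φ σ (_ ≠̇ _) = same
Lowered-instOF φ σ (X _) = lowerI
Lowered-instOF φ σ (ψ ∧̇ χ) = Lowered-instOF φ σ ψ ∧ᴸ Lowered-instOF φ σ χ
Lowered-instOF φ σ (ψ ∨̇ χ) = Lowered-instOF φ σ ψ ∨ᴸ Lowered-instOF φ σ χ
Lowered-instOF φ σ (∀̇ ψ) = ∀ᴸ (Lowered-instOF φ (exts σ) ψ)
Lowered-instOF φ σ (∃̇ ψ) = ∃ᴸ (Lowered-instOF φ (exts σ) ψ)

mutual
  Lowered-k : ∀ {l n} {ψ ψ′ : Fm n} → Lowered l ψ ψ′ → ∀ {a} → a ∈ k ψ′ → a ∈ k ψ ⊎ a ≡ l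
  Lowered-k same m = inj₁ m
  Lowered-k lowerI (here refl) = inj₂ refl
  Lowered-k (_∧ᴸ_ {ψ = ψ} {ψ′} L₁ L₂) m = Lowered-k-++ {ψ = ψ} {ψ′} L₁ L₂ m
  Lowered-k (_∨ᴸ_ {ψ = ψ} {ψ′} L₁ L₂) m = Lowered-k-++ {ψ = ψ} {ψ′} L₁ L₂ m
  Lowered-k (∀ᴸ L) m = Lowered-k L m
  Lowered-k (∃ᴸ L) m = Lowered-k L m

  Lowered-k-++ : ∀ {l n} {ψ ψ′ χ χ′ : Fm n} → Lowered l ψ ψ′ → Lowered l χ χ′ →
    ∀ {a} → a ∈ k ψ′ ++ k χ′ → a ∈ k ψ ++ k χ ⊎ a ≡ l
  Lowered-k-++ {ψ = ψ} {ψ′} L₁ L₂ m with ∈-++⁻ (k ψ′) m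
  ... | inj₁ m′ = [ (λ m″ → inj₁ (∈-++⁺ˡ m″)) , inj₂ ]′ (Lowered-k L₁ m′)
  ... | inj₂ m′ = [ (λ m″ → inj₁ (∈-++⁺ʳ (k ψ) m″)) , inj₂ ]′ (Lowered-k L₂ m′)

Lowered-pick2 : ∀ {l} γ {ψ ψ′ χ χ′ : Sentence} → Lowered l ψ ψ′ → Lowered l χ χ′ →
  Lowered l (pick2 ψ χ γ) (pick2 ψ′ χ′ γ)
Lowered-pick2 γ L₁ L₂ with γ ≡ᵗ zeroᵗ
... | true = L₁
... | false = L₂

LowerCover : Tm → List Sentence → List Sentence → Set
LowerCover l Γ Γ′ = ∀ {ψ} → ψ ∈ Γ → Σ Sentence λ ψ′ → ψ′ ∈ Γ′ × Lowered l ψ ψ′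

LowerCover-refl : ∀ {l Γ} → LowerCover l Γ Γ
LowerCover-refl m = _ , m , same

LowerCover-∷ : ∀ {l Γ Γ′ χ χ′} → LowerCover l Γ Γ′ → Lowered l χ χ′ → LowerCover l (χ ∷ Γ) (χ′ ∷ Γ′)
LowerCover-∷ {χ′ = χ′} _ L (here refl) = χ′ , here refl , L
LowerCover-∷ cover _ (there m) = let ψ′ , m′ , L = cover m in ψ′ , there m′ , L

Controlled-∷ : ∀ 𝓗 {Γ χ} → Controlled 𝓗 Γ → All (𝓗 ∅) (k χ) → Controlled 𝓗 (χ ∷ Γ)
Controlled-∷ _ _ kχ (here refl) = kχ
Controlled-∷ _ ctl _ (there m) = ctl m

Controlled-lowered-∷ : ∀ 𝓗 𝓗′ {l Γ′ χ χ′} → (∀ {x} → 𝓗 ∅ x → 𝓗′ ∅ x) → Controlled 𝓗 Γ′ →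
  All (𝓗′ ∅) (k χ) → 𝓗′ ∅ l → Lowered l χ χ′ → Controlled 𝓗′ (χ′ ∷ Γ′)
Controlled-lowered-∷ _ _ _ _ kχ hl L (here refl) =
  tabulate (λ m → [ lookup kχ , (λ { refl → hl }) ]′ (Lowered-k L m))
Controlled-lowered-∷ _ _ inc ctl _ _ _ (there m) = All-map inc (ctl m)

⋀-lowered : ∀ {𝓗 a ρ Γ′ l ψ ψ′ δ f} → Lowered l ψ ψ′ → ψ′ ∈ Γ′ → junction ψ ≡ ⋀ δ f →
  (∀ γ → WF γ → γ ≺ δ → ∀ {χ′} → Lowered l (f γ) χ′ →
     Σ Tm λ a₀ → a₀ ≺ a × ((𝓗 [ ｛ γ ｝ ]) ⊢[ a₀ , ρ ] (χ′ ∷ Γ′))) →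
  Side 𝓗 a Γ′ → 𝓗 ⊢[ a , ρ ] Γ′
⋀-lowered same m j premises s = ⋀-rule s m j (λ γ wγ γ≺δ → premises γ wγ γ≺δ same)
⋀-lowered (L₁ ∧ᴸ L₂) m refl premises s =
  ⋀-rule s m refl (λ γ wγ γ≺2 → premises γ wγ γ≺2 (Lowered-pick2 γ L₁ L₂))
⋀-lowered (∀ᴸ L) m refl premises s =
  ⋀-rule s m refl (λ γ wγ γ≺ω → premises γ wγ γ≺ω (Lowered-substF _ L))

-- A lowered disjunction I^{≺l} keeps the witness γ, which is legal because γ ≺ a ≼ l.
⋁-lowered : ∀ {𝓗 a ρ Γ′ l ψ ψ′ δ f γ a₀} → Lowered l ψ ψ′ → ψ′ ∈ Γ′ → junction ψ ≡ ⋁ δ f →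
  a ≼ l → WF γ → γ ≺ δ → γ ≺ a → 𝓗 ∅ γ → a₀ ≺ a →
  (∀ {χ′} → Lowered l (f γ) χ′ → 𝓗 ⊢[ a₀ , ρ ] (χ′ ∷ Γ′)) →
  Side 𝓗 a Γ′ → 𝓗 ⊢[ a , ρ ] Γ′
⋁-lowered same m j _ wγ γ≺δ γ≺a hγ a₀≺a premise s = ⋁-rule s m j wγ γ≺δ γ≺a hγ a₀≺a (premise same)
⋁-lowered {a = a} {l = l} {γ = γ} lowerI m refl a≼l wγ _ γ≺a hγ a₀≺a premise s =
  ⋁-rule s m refl wγ (≺-≼-trans γ a l γ≺a a≼l) γ≺a hγ a₀≺a (premise same)
⋁-lowered {γ = γ} (L₁ ∨ᴸ L₂) m refl _ wγ γ≺δ γ≺a hγ a₀≺a premise s =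
  ⋁-rule s m refl wγ γ≺δ γ≺a hγ a₀≺a (premise (Lowered-pick2 γ L₁ L₂))
⋁-lowered (∃ᴸ L) m refl _ wγ γ≺δ γ≺a hγ a₀≺a premise s =
  ⋁-rule s m refl wγ γ≺δ γ≺a hγ a₀≺a (premise (Lowered-substF _ L))

-- Boundedness: a derivation of height a ≼ l ≺ Ω never uses Fix, so I^{≺Ω} may be lowered to I^{≺l}.
boundedness : ∀ {𝓗 a ρ Γ Γ′ l} → 𝓗 ⊢[ a , ρ ] Γ → Monotone 𝓗 → a ≼ l → l ≺ Ω → 𝓗 ∅ l →
  LowerCover l Γ Γ′ → Controlled 𝓗 Γ′ → 𝓗 ⊢[ a , ρ ] Γ′
boundedness {𝓗} {a} {ρ} {Γ′ = Γ′} {l} (⋀-rule {δ = δ} {f = f} (ha , _) m j premises) mono a≼l l≺Ω hl cover ctl =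
  let _ , m′ , L = cover m in ⋀-lowered L m′ j lowered (ha , ctl)
  where
  lowered : ∀ γ → WF γ → γ ≺ δ → ∀ {χ′} → Lowered l (f γ) χ′ →
    Σ Tm λ a₀ → a₀ ≺ a × ((𝓗 [ ｛ γ ｝ ]) ⊢[ a₀ , ρ ] (χ′ ∷ Γ′))
  lowered γ wγ γ≺δ L =
    let a₀ , a₀≺a , d = premises γ wγ γ≺δ
        hl′ = mono ∅⊆ l hl
    in a₀ , a₀≺a ,
       boundedness d (Monotone-[] ｛ γ ｝ mono) (≺⇒≼ a₀ l (≺-≼-trans a₀ a l a₀≺a a≼l)) l≺Ω hl′
         (LowerCover-∷ cover L)
         (Controlled-lowered-∷ 𝓗 (𝓗 [ ｛ γ ｝ ]) (mono ∅⊆ _) ctl (proj₂ (side d) (here refl)) hl′ L)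
boundedness {𝓗} {a} {l = l} (⋁-rule {α′ = a₀} (ha , _) m j wγ γ≺δ γ≺a hγ a₀≺a d) mono a≼l l≺Ω hl cover ctl =
  let _ , m′ , L = cover m in
  ⋁-lowered L m′ j a≼l wγ γ≺δ γ≺a hγ a₀≺a
    (λ L′ → boundedness d mono (≺⇒≼ a₀ l (≺-≼-trans a₀ a l a₀≺a a≼l)) l≺Ω hl (LowerCover-∷ cover L′)
              (Controlled-lowered-∷ 𝓗 𝓗 (λ h → h) ctl (proj₂ (side d) (here refl)) hl L′))
    (ha , ctl)
boundedness {𝓗} {a} {ρ} {Γ} {Γ′} {l} (cut {α′ = a₀} ψ (ha , _) sψ rk≺ρ a₀≺a d₁ d₂) mono a≼l l≺Ω hl cover ctl =
  cut ψ (ha , ctl) sψ rk≺ρ a₀≺a (premise d₁) (premise d₂)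
  where
  premise : ∀ {χ} → 𝓗 ⊢[ a₀ , ρ ] (χ ∷ Γ) → 𝓗 ⊢[ a₀ , ρ ] (χ ∷ Γ′)
  premise d = boundedness d mono (≺⇒≼ a₀ l (≺-≼-trans a₀ a l a₀≺a a≼l)) l≺Ω hl (LowerCover-∷ cover same)
                (Controlled-lowered-∷ 𝓗 𝓗 (λ h → h) ctl (proj₂ (side d) (here refl)) hl same)
boundedness {a = a} {l = l} (fix _ Ω≼a _ _ _) _ a≼l l≺Ω _ _ _ =
  ⊥-elim (≼-≺-trans Ω l Ω (≼-trans Ω a l Ω≼a a≼l) l≺Ω)

record CoeffBound (α : Tm) (Xs : Pred) : Set where
  constructor coeffBound
  field ⊆Cϑ : ∀ ξ → WF ξ → α ≺ ξ → Xs ⊆ C ξ (ϑ ξ)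
open CoeffBound

record ControlledBy (α : Tm) (Xs : Pred) (Γ : List Sentence) : Set where
  constructor controlledBy
  field controlled : ∀ {ψ} → ψ ∈ Γ → All (H α Xs) (k ψ)
open ControlledBy

record Below𝓗 (𝓗 : Op) (α : Tm) (Xs : Pred) : Set₁ where
  constructor below𝓗
  field ⊆H : ∀ Y → 𝓗 Y ⊆ H α (Xs ∪ Y)
open Below𝓗

data Represented (α : Tm) (Xs : Pred) (Γ′ : List Sentence) : Sentence → Set where
  present : ∀ {ψ} → ψ ∈ Γ′ → ΣΩ-Sentence ψ → Represented α Xs Γ′ ψ
  lowered : ∀ {φ t l} → ¬I l φ t ∈ Γ′ → l ≺ Ω → H α Xs l → Represented α Xs Γ′ (¬I Ω φ t)

Covers : Tm → Pred → List Sentence → List Sentence → Set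
Covers α Xs Γ Γ′ = ∀ {ψ} → ψ ∈ Γ → Represented α Xs Γ′ ψ

H-Monotone : ∀ a → Monotone (H a)
H-Monotone a Y⊆Z _ = H-monoʳ a Y⊆Z

height∈H : ∀ {𝓗 α Xs b ρ Δ} → Below𝓗 𝓗 α Xs → 𝓗 ⊢[ b , ρ ] Δ → H α Xs b
height∈H {α = α} below d = H-∪∅⁻ α (⊆H below ∅ _ (proj₁ (side d)))

principal∈H : ∀ {𝓗 α Xs b ρ χ Δ} → Below𝓗 𝓗 α Xs → 𝓗 ⊢[ b , ρ ] (χ ∷ Δ) → All (H α Xs) (k χ)
principal∈H {α = α} below d = All-map (λ h → H-∪∅⁻ α (⊆H below ∅ _ h)) (proj₂ (side d) (here refl))

Represented-∷ : ∀ {α Xs α′ Xs′ Γ′ χ′ ψ} → (∀ {x} → H α Xs x → H α′ Xs′ x) →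
  Represented α Xs Γ′ ψ → Represented α′ Xs′ (χ′ ∷ Γ′) ψ
Represented-∷ _ (present m sψ) = present (there m) sψ
Represented-∷ inc (lowered m l≺Ω hl) = lowered (there m) l≺Ω (inc hl)

Covers-∷ : ∀ {α Xs α′ Xs′ Γ Γ′ χ χ′} → (∀ {x} → H α Xs x → H α′ Xs′ x) →
  Covers α Xs Γ Γ′ → Represented α′ Xs′ (χ′ ∷ Γ′) χ → Covers α′ Xs′ (χ ∷ Γ) (χ′ ∷ Γ′)
Covers-∷ _ _ r (here refl) = r
Covers-∷ inc cover _ (there m) = Represented-∷ inc (cover m)

ControlledBy-∷ : ∀ {α Xs α′ Xs′ Γ′ χ′} → (∀ {x} → H α Xs x → H α′ Xs′ x) →
  ControlledBy α Xs Γ′ → All (H α′ Xs′) (k χ′) → ControlledBy α′ Xs′ (χ′ ∷ Γ′)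
ControlledBy-∷ inc ctl kχ′ = controlledBy λ { (here refl) → kχ′ ; (there m) → All-map inc (controlled ctl m) }

CoeffBound-∪ : ∀ {α Xs} γ → WF γ → CoeffBound α Xs → (∀ ξ → WF ξ → α ≺ ξ → γ ≺ ϑ ξ) → CoeffBound α (Xs ∪ ｛ γ ｝)
CoeffBound-∪ γ wγ bound γ≺ϑ = coeffBound λ where
  ξ wξ α≺ξ x (inj₁ x∈Xs) → ⊆Cϑ bound ξ wξ α≺ξ x x∈Xs
  ξ wξ α≺ξ .γ (inj₂ refl) → c≺ wγ (γ≺ϑ ξ wξ α≺ξ)

Below𝓗-[] : ∀ {𝓗 α Xs} γ → Below𝓗 𝓗 α Xs → Below𝓗 (𝓗 [ ｛ γ ｝ ]) α (Xs ∪ ｛ γ ｝)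
Below𝓗-[] {α = α} γ below = below𝓗 λ Y x h →
  H-monoʳ α (λ { _ (inj₁ x∈Xs) → inj₁ (inj₁ x∈Xs)
              ; _ (inj₂ (inj₁ refl)) → inj₁ (inj₂ refl)
              ; _ (inj₂ (inj₂ y)) → inj₂ y })
    (⊆H below (｛ γ ｝ ∪ Y) x h)

Below𝓗-monoˡ : ∀ {𝓗 α α′ Xs} → α ≼ α′ → Below𝓗 𝓗 α Xs → Below𝓗 𝓗 α′ Xs
Below𝓗-monoˡ {α = α} {α′} α≼α′ below = below𝓗 λ Y x h → H-monoˡ α α′ α≼α′ (⊆H below Y x h)

CoeffBound-monoˡ : ∀ {α α′ Xs} → α ≼ α′ → CoeffBound α Xs → CoeffBound α′ Xs
CoeffBound-monoˡ {α} {α′} α≼α′ bound = coeffBound λ ξ wξ α′≺ξ → ⊆Cϑ bound ξ wξ (≼-≺-trans α α′ ξ α≼α′ α′≺ξ)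

H⊆Cϑ : ∀ {α Xs x} → CoeffBound α Xs → H α Xs x → ∀ ξ → WF ξ → α ≺ ξ → C ξ (ϑ ξ) x
H⊆Cϑ {α} bound hx ξ wξ α≺ξ = H⊆C α ξ (ϑ ξ) hx α≺ξ wξ wξ (⊆Cϑ bound ξ wξ α≺ξ)

H∩Ω≺ϑ : ∀ {α Xs x} → CoeffBound α Xs → H α Xs x → x ≺ Ω → ∀ ξ → WF ξ → α ≺ ξ → x ≺ ϑ ξ
H∩Ω≺ϑ {x = x} bound hx x≺Ω ξ wξ α≺ξ = C-≺Ω⇒≺ϑ ξ x (H⊆Cϑ bound hx ξ wξ α≺ξ) x≺Ω

H-ϑ+ω : ∀ {α Y β} c → H α Y α → H α Y β → α +ω β ≼ c → H c Y (ϑ (α +ω β))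
H-ϑ+ω {α} {β = β} c hα hβ η≼c =
  H-ϑ c (α +ω β) (H-monoˡ α c α≼c (H-+ω α α β hα hβ)) η≼c
  where
  α≼c : α ≼ c
  α≼c = ≺⇒≼ α c (≺-≼-trans α (α +ω β) c (+ω-increasing α β) η≼c)

ϑ-mono-H : ∀ {α Y x y} → WF y → CoeffBound α Y → H α Y x → α ≺ y → x ≺ y → ϑ x ≺ ϑ y
ϑ-mono-H {x = x} {y} wy bound hx α≺y x≺y = ϑ-mono x y x≺y (H⊆Cϑ bound hx y wy α≺y)

ϑ+ω-mono : ∀ {α Y β₀ β} → WF α → WF β → CoeffBound α Y → H α Y α → H α Y β₀ → β₀ ≺ β →
  ϑ (α +ω β₀) ≺ ϑ (α +ω β)
ϑ+ω-mono {α} {β₀ = β₀} {β} wα wβ bound hα hβ₀ β₀≺β =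
  ϑ-mono-H (WF-+ω α β wα wβ) bound (H-+ω α α β₀ hα hβ₀)
    (+ω-increasing α β) (+ω-monoʳ-≺ α β₀ β β₀≺β)

ϑ≺ϑ+ω : ∀ {α Y} β → WF α → WF β → CoeffBound α Y → H α Y α → ϑ α ≺ ϑ (α +ω β)
ϑ≺ϑ+ω {α} β wα wβ bound hα =
  ϑ-mono-H (WF-+ω α β wα wβ) bound hα (+ω-increasing α β) (+ω-increasing α β)

ϑ+ω+ω-mono : ∀ {α Y β₀ β} → WF α → WF β → CoeffBound α Y → H α Y α → H α Y β₀ → β₀ ≺ β →
  ϑ (α +ω β₀ +ω β₀) ≺ ϑ (α +ω β)
ϑ+ω+ω-mono {α} {β₀ = β₀} {β} wα wβ bound hα hβ₀ β₀≺β =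
  ϑ-mono-H (WF-+ω α β wα wβ) bound (H-+ω α η₀ β₀ (H-+ω α α β₀ hα hβ₀) hβ₀)
    (+ω-increasing α β) (+ω-twice≺ α β₀ β β₀≺β)
  where
  η₀ : Tm
  η₀ = α +ω β₀

raise : ∀ {α Y β₀ β Γ} → WF α → WF β → CoeffBound α Y → H α Y α → H α Y β₀ → β₀ ≺ β →
  H[ α +ω β₀ , Y ] ⊢[ ϑ (α +ω β₀) , ϑ (α +ω β₀) ] Γ →
  ϑ (α +ω β₀) ≺ ϑ (α +ω β) × H[ α +ω β , Y ] ⊢[ ϑ (α +ω β₀) , ϑ (α +ω β) ] Γ
raise {α} {Y} {β₀} {β} wα wβ bound hα hβ₀ β₀≺β d =
  ϑη₀≺ϑη ,
  ⊢-weaken d (λ W → H-mono η₀ η η₀≼η (λ _ y → y)) (≺⇒≼ (ϑ η₀) (ϑ η) ϑη₀≺ϑη) (≼-refl (ϑ η₀))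
    (H-∪∅⁺ η (H-ϑ+ω η hα hβ₀ η₀≼η))
  where
  η₀ η : Tm
  η₀ = α +ω β₀
  η = α +ω β
  η₀≼η : η₀ ≼ η
  η₀≼η = ≺⇒≼ η₀ η (+ω-monoʳ-≺ α β₀ β β₀≺β)
  ϑη₀≺ϑη : ϑ η₀ ≺ ϑ η
  ϑη₀≺ϑη = ϑ+ω-mono wα wβ bound hα hβ₀ β₀≺β

ControlledBy⇒Controlled : ∀ {α η Xs Γ′} → α ≼ η → ControlledBy α Xs Γ′ → Controlled H[ η , Xs ] Γ′
ControlledBy⇒Controlled {α} {η} α≼η ctl m = All-map (λ h → H-∪∅⁺ η (H-monoˡ α η α≼η h)) (controlled ctl m)

collapsed-side : ∀ {α Xs β Γ′} → WF α → H α Xs α → H α Xs β → ControlledBy α Xs Γ′ →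
  Side H[ α +ω β , Xs ] (ϑ (α +ω β)) Γ′
collapsed-side {α} {β = β} wα hα hβ ctl =
  H-∪∅⁺ (α +ω β) (H-ϑ+ω (α +ω β) hα hβ (≼-refl (α +ω β))) ,
  ControlledBy⇒Controlled (≺⇒≼ α (α +ω β) (+ω-increasing α β)) ctl

lower-to-ϑ : ∀ {η Xs Γ Γ′} → H η Xs (ϑ η) → H[ η , Xs ] ⊢[ ϑ η , ϑ η ] Γ →
  LowerCover (ϑ η) Γ Γ′ → Controlled H[ η , Xs ] Γ′ → H[ η , Xs ] ⊢[ ϑ η , ϑ η ] Γ′
lower-to-ϑ {η} {Xs} hϑη d cover ctl =
  boundedness d (Monotone-[] Xs (H-Monotone η)) (≼-refl (ϑ η)) tt (H-∪∅⁺ η hϑη) cover ctl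

Collapsed⋀Premises : Tm → Pred → Tm → Tm → (Tm → Sentence) → List Sentence → Set₁
Collapsed⋀Premises α Xs β δ f Γ′ =
  ∀ γ → WF γ → γ ≺ δ → ΣΩ-Sentence (f γ) → (∀ ξ → WF ξ → α ≺ ξ → γ ≺ ϑ ξ) →
  Σ Tm λ β₀ → β₀ ≺ β × H α (Xs ∪ ｛ γ ｝) β₀ ×
    H[ α +ω β₀ , Xs ∪ ｛ γ ｝ ] ⊢[ ϑ (α +ω β₀) , ϑ (α +ω β₀) ] (f γ ∷ Γ′)

collapse-⋀-premise : ∀ {α Xs β Γ′ δ f} γ → WF α → H α Xs α → H α Xs β → CoeffBound α Xs →
  Collapsed⋀Premises α Xs β δ f Γ′ → WF γ → γ ≺ δ → ΣΩ-Sentence (f γ) → (∀ ξ → WF ξ → α ≺ ξ → γ ≺ ϑ ξ) →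
  Σ Tm λ a₀ → a₀ ≺ ϑ (α +ω β) × ((H[ α +ω β , Xs ] [ ｛ γ ｝ ]) ⊢[ a₀ , ϑ (α +ω β) ] (f γ ∷ Γ′))
collapse-⋀-premise {α} {Xs} {β} γ wα hα hβ bound premises wγ γ≺δ sγ γ≺ϑ =
  let β₀ , β₀≺β , hβ₀ , d = premises γ wγ γ≺δ sγ γ≺ϑ
      ϑη₀≺ϑη , d′ = raise wα (proj₁ hβ) (CoeffBound-∪ γ wγ bound γ≺ϑ)
                      (H-monoʳ α (λ _ → inj₁) hα) hβ₀ β₀≺β d
  in ϑ (α +ω β₀) , ϑη₀≺ϑη , ⊢-mono d′ (λ W _ → H-monoʳ (α +ω β) ∪-assoc)
  where
  ∪-assoc : ∀ {W} → ((Xs ∪ ｛ γ ｝) ∪ W) ⊆ (Xs ∪ (｛ γ ｝ ∪ W))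
  ∪-assoc _ (inj₁ (inj₁ x)) = inj₁ x
  ∪-assoc _ (inj₁ (inj₂ g)) = inj₂ (inj₁ g)
  ∪-assoc _ (inj₂ w) = inj₂ (inj₂ w)

collapse-⋀ : ∀ {α Xs β Γ′ ψ δ f} → WF α → H α Xs α → H α Xs β → CoeffBound α Xs → ControlledBy α Xs Γ′ →
  Represented α Xs Γ′ ψ → junction ψ ≡ ⋀ δ f → Collapsed⋀Premises α Xs β δ f Γ′ →
  H[ α +ω β , Xs ] ⊢[ ϑ (α +ω β) , ϑ (α +ω β) ] Γ′
collapse-⋀ {α} {ψ = ψ} wα hα hβ bound ctl (present m sψ) j premises =
  ⋀-rule (collapsed-side wα hα hβ ctl) m j λ γ wγ γ≺δ →
    collapse-⋀-premise γ wα hα hβ bound premises wγ γ≺δ (ΣΩ-premise ψ sψ (inj₁ j) wγ γ≺δ)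
      (index≺ϑ γ (⋀-index-bound ψ {γ = γ} sψ j γ≺δ))
  where
  index≺ϑ : ∀ γ → γ ≺ ωᵗ ⊎ Σ Tm (λ a → a ∈ k ψ × a ≺ Ω × γ ≺ a) → ∀ ξ → WF ξ → α ≺ ξ → γ ≺ ϑ ξ
  index≺ϑ γ (inj₁ γ≺ω) ξ _ _ = ≺-trans γ ωᵗ (ϑ ξ) γ≺ω tt
  index≺ϑ γ (inj₂ (a , a∈kψ , a≺Ω , γ≺a)) ξ wξ α≺ξ =
    ≺-trans γ a (ϑ ξ) γ≺a (H∩Ω≺ϑ bound (lookup (controlled ctl m) a∈kψ) a≺Ω ξ wξ α≺ξ)
collapse-⋀ wα hα hβ bound ctl (lowered {φ} {t} {l} m l≺Ω hl) refl premises =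
  ⋀-rule (collapsed-side wα hα hβ ctl) m refl λ γ wγ γ≺l →
    let γ≺Ω = ≺-trans γ l Ω γ≺l l≺Ω in
    collapse-⋀-premise γ wα hα hβ bound premises wγ γ≺Ω (ΣΩ-neg-instOF φ γ t wγ γ≺Ω)
      (λ ξ wξ α≺ξ → ≺-trans γ l (ϑ ξ) γ≺l (H∩Ω≺ϑ bound hl l≺Ω ξ wξ α≺ξ))

collapse-⋁ : ∀ {α Xs β Γ′ ψ δ f γ β₀} → WF α → H α Xs α → H α Xs β → CoeffBound α Xs → ControlledBy α Xs Γ′ →
  Represented α Xs Γ′ ψ → junction ψ ≡ ⋁ δ f → WF γ → γ ≺ δ → H α Xs γ → β₀ ≺ β → H α Xs β₀ →
  (ΣΩ-Sentence (f γ) → H[ α +ω β₀ , Xs ] ⊢[ ϑ (α +ω β₀) , ϑ (α +ω β₀) ] (f γ ∷ Γ′)) →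
  H[ α +ω β , Xs ] ⊢[ ϑ (α +ω β) , ϑ (α +ω β) ] Γ′
collapse-⋁ {α} {β = β} {ψ = ψ} {γ = γ} wα hα hβ bound ctl (present m sψ) j wγ γ≺δ hγ β₀≺β hβ₀ premise =
  let ϑη₀≺ϑη , d = raise wα (proj₁ hβ) bound hα hβ₀ β₀≺β (premise (ΣΩ-premise ψ sψ (inj₂ j) wγ γ≺δ)) in
  ⋁-rule (collapsed-side wα hα hβ ctl) m j wγ γ≺δ
    (H∩Ω≺ϑ bound hγ (⋁-index≺Ω ψ {γ = γ} (proj₁ sψ) j γ≺δ) η (WF-+ω α β wα (proj₁ hβ)) (+ω-increasing α β))
    (H-∪∅⁺ η (H-monoˡ α η (≺⇒≼ α η (+ω-increasing α β)) hγ))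
    ϑη₀≺ϑη d
  where
  η : Tm
  η = α +ω β

-- A cut formula without I^{≺Ω} has all its levels in H_α(X) ∩ Ω ⊆ ϑη, hence rank ≺ ϑη.
collapse-cut : ∀ {α Xs β β₀ Γ′} ψ → WF α → H α Xs α → H α Xs β → CoeffBound α Xs → ControlledBy α Xs Γ′ →
  IsSentence ψ → All (_≢ Ω) (k ψ) → All (H α Xs) (k ψ) → β₀ ≺ β → H α Xs β₀ →
  H[ α +ω β₀ , Xs ] ⊢[ ϑ (α +ω β₀) , ϑ (α +ω β₀) ] (ψ ∷ Γ′) →
  H[ α +ω β₀ , Xs ] ⊢[ ϑ (α +ω β₀) , ϑ (α +ω β₀) ] (neg ψ ∷ Γ′) →
  H[ α +ω β , Xs ] ⊢[ ϑ (α +ω β) , ϑ (α +ω β) ] Γ′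
collapse-cut {α} {β = β} ψ wα hα hβ bound ctl sψ Ω∉kψ kψ∈H β₀≺β hβ₀ d₁ d₂ =
  let ϑη₀≺ϑη , d₁′ = raise wα (proj₁ hβ) bound hα hβ₀ β₀≺β d₁
      _ , d₂′ = raise wα (proj₁ hβ) bound hα hβ₀ β₀≺β d₂
  in cut ψ (collapsed-side wα hα hβ ctl) sψ (rk-≺ϑ ψ η kψ≺ϑη) ϑη₀≺ϑη d₁′ d₂′
  where
  η : Tm
  η = α +ω β
  kψ≺ϑη : All (_≺ ϑ η) (k ψ)
  kψ≺ϑη = tabulate λ {a} a∈kψ →
    H∩Ω≺ϑ bound (lookup kψ∈H a∈kψ) (≼Ω∧≢Ω⇒≺Ω a (proj₂ (lookup sψ a∈kψ)) (lookup Ω∉kψ a∈kψ))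
      η (WF-+ω α β wα (proj₁ hβ)) (+ω-increasing α β)

collapse-Ω-cut : ∀ {α Xs β β₀ Γ′} φ t → WF α → H α Xs α → H α Xs β → CoeffBound α Xs → ControlledBy α Xs Γ′ →
  β₀ ≺ β → H α Xs β₀ →
  H[ α +ω β₀ , Xs ] ⊢[ ϑ (α +ω β₀) , ϑ (α +ω β₀) ] (I Ω φ t ∷ Γ′) →
  H[ α +ω β₀ +ω β₀ , Xs ] ⊢[ ϑ (α +ω β₀ +ω β₀) , ϑ (α +ω β₀ +ω β₀) ] (¬I (ϑ (α +ω β₀)) φ t ∷ Γ′) →
  H[ α +ω β , Xs ] ⊢[ ϑ (α +ω β) , ϑ (α +ω β) ] Γ′
collapse-Ω-cut {α} {Xs} {β} {β₀} {Γ′} φ t wα hα hβ bound ctl β₀≺β hβ₀ d₁ d₂ =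
  cut (I (ϑ η₀) φ t) (collapsed-side wα hα hβ ctl) ((WF-+ω α β₀ wα (proj₁ hβ₀) , tt) ∷ [])
    (ϑ+ω-mono wα (proj₁ hβ) bound hα hβ₀ β₀≺β) ϑη₁≺ϑη left right
  where
  η η₀ η₁ : Tm
  η = α +ω β
  η₀ = α +ω β₀
  η₁ = η₀ +ω β₀
  α≼η₀ : α ≼ η₀
  α≼η₀ = ≺⇒≼ α η₀ (+ω-increasing α β₀)
  hη₀ : H α Xs η₀
  hη₀ = H-+ω α α β₀ hα hβ₀
  ϑη₁≺ϑη : ϑ η₁ ≺ ϑ η
  ϑη₁≺ϑη = ϑ+ω+ω-mono wα (proj₁ hβ) bound hα hβ₀ β₀≺β
  hϑη₁ : H[ η , Xs ] ∅ (ϑ η₁)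
  hϑη₁ = H-∪∅⁺ η (H-ϑ η η₁ (H-monoˡ α η (≺⇒≼ α η (+ω-increasing α β)) (H-+ω α η₀ β₀ hη₀ hβ₀))
                            (≺⇒≼ η₁ η (+ω-twice≺ α β₀ β β₀≺β)))
  raise-to-η : ∀ a → a ≼ η → ∀ W → H[ a , Xs ] W ⊆ H[ η , Xs ] W
  raise-to-η a a≼η W = H-mono a η a≼η (λ _ y → y)
  left : H[ η , Xs ] ⊢[ ϑ η₁ , ϑ η ] (I (ϑ η₀) φ t ∷ Γ′)
  left = ⊢-weaken
    (lower-to-ϑ (H-ϑ+ω η₀ hα hβ₀ (≼-refl η₀)) d₁ (LowerCover-∷ LowerCover-refl lowerI)
       (Controlled-∷ H[ η₀ , Xs ] (ControlledBy⇒Controlled α≼η₀ ctl)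
          (H-∪∅⁺ η₀ (H-ϑ+ω η₀ hα hβ₀ (≼-refl η₀)) ∷ [])))
    (raise-to-η η₀ (≺⇒≼ η₀ η (+ω-monoʳ-≺ α β₀ β β₀≺β)))
    (≺⇒≼ (ϑ η₀) (ϑ η) (ϑ+ω-mono wα (proj₁ hβ) bound hα hβ₀ β₀≺β))
    (≺⇒≼ (ϑ η₀) (ϑ η₁) (ϑ≺ϑ+ω β₀ (WF-+ω α β₀ wα (proj₁ hβ₀)) (proj₁ hβ₀) (CoeffBound-monoˡ α≼η₀ bound)
                                  (H-monoˡ α η₀ α≼η₀ hη₀)))
    hϑη₁
  right : H[ η , Xs ] ⊢[ ϑ η₁ , ϑ η ] (¬I (ϑ η₀) φ t ∷ Γ′)
  right = ⊢-weaken d₂ (raise-to-η η₁ (≺⇒≼ η₁ η (+ω-twice≺ α β₀ β β₀≺β))) (≺⇒≼ (ϑ η₁) (ϑ η) ϑη₁≺ϑη)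
            (≼-refl (ϑ η₁)) hϑη₁

collapse-fix : ∀ {α Xs β β₀ Γ′} φ t → WF α → H α Xs α → H α Xs β → CoeffBound α Xs → ControlledBy α Xs Γ′ →
  I Ω φ t ∈ Γ′ → β₀ ≺ β → H α Xs β₀ →
  H[ α +ω β₀ , Xs ] ⊢[ ϑ (α +ω β₀) , ϑ (α +ω β₀) ] ((φ ⟦ t ,I≺ Ω ⟧) ∷ Γ′) →
  H[ α +ω β , Xs ] ⊢[ ϑ (α +ω β) , ϑ (α +ω β) ] Γ′
collapse-fix {α} {Xs} {β} {β₀} {Γ′} φ t wα hα hβ bound ctl m β₀≺β hβ₀ d =
  let ϑη₀≺ϑη , raised = raise wα (proj₁ hβ) bound hα hβ₀ β₀≺β bounded in
  ⋁-rule (collapsed-side wα hα hβ ctl) m refl (WF-+ω α β₀ wα (proj₁ hβ₀)) tt ϑη₀≺ϑη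
    (H-∪∅⁺ η (H-ϑ+ω η hα hβ₀ (≺⇒≼ η₀ η (+ω-monoʳ-≺ α β₀ β β₀≺β)))) ϑη₀≺ϑη raised
  where
  η η₀ : Tm
  η = α +ω β
  η₀ = α +ω β₀
  α≼η₀ : α ≼ η₀
  α≼η₀ = ≺⇒≼ α η₀ (+ω-increasing α β₀)
  hϑη₀ : H η₀ Xs (ϑ η₀)
  hϑη₀ = H-ϑ+ω η₀ hα hβ₀ (≼-refl η₀)
  bounded : H[ η₀ , Xs ] ⊢[ ϑ η₀ , ϑ η₀ ] ((φ ⟦ t ,I≺ ϑ η₀ ⟧) ∷ Γ′)
  bounded = lower-to-ϑ hϑη₀ d (LowerCover-∷ LowerCover-refl (Lowered-instOF φ (λ _ → t) φ))
              (Controlled-∷ H[ η₀ , Xs ] (ControlledBy⇒Controlled α≼η₀ ctl)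
                 (All-map (λ { refl → H-∪∅⁺ η₀ hϑη₀ }) (k-instOF φ (ϑ η₀) (λ _ → t) φ)))

mutual
  collapse : ∀ {𝓗 β Γ} → 𝓗 ⊢[ β , Ω +ᵗ numᵗ 1 ] Γ → ∀ α Xs Γ′ →
    Below𝓗 𝓗 α Xs → WF α → H α Xs α → CoeffBound α Xs → Covers α Xs Γ Γ′ → ControlledBy α Xs Γ′ →
    H[ α +ω β , Xs ] ⊢[ ϑ (α +ω β) , ϑ (α +ω β) ] Γ′
  collapse {𝓗} {β} d@(⋀-rule {δ = δ} {f = f} _ m j premises) α Xs Γ′ below wα hα bound cover ctl =
    collapse-⋀ wα hα (height∈H below d) bound ctl (cover m) j collapsed
    where
    collapsed : Collapsed⋀Premises α Xs β δ f Γ′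
    collapsed γ wγ γ≺δ sγ γ≺ϑ =
      let β₀ , β₀≺β , d₀ = premises γ wγ γ≺δ
          below′ : Below𝓗 (𝓗 [ ｛ γ ｝ ]) α (Xs ∪ ｛ γ ｝)
          below′ = Below𝓗-[] γ below
          inc : ∀ {x} → H α Xs x → H α (Xs ∪ ｛ γ ｝) x
          inc = H-monoʳ α (λ _ → inj₁)
      in β₀ , β₀≺β , height∈H below′ d₀ ,
         collapse d₀ α (Xs ∪ ｛ γ ｝) (f γ ∷ Γ′) below′ wα (inc hα) (CoeffBound-∪ γ wγ bound γ≺ϑ)
           (Covers-∷ inc cover (present (here refl) sγ)) (ControlledBy-∷ inc ctl (principal∈H below′ d₀))
  collapse d@(⋁-rule {f = f} {γ = γ} _ m j wγ γ≺δ _ hγ β₀≺β d₀) α Xs Γ′ below wα hα bound cover ctl =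
    collapse-⋁ wα hα (height∈H below d) bound ctl (cover m) j wγ γ≺δ (H-∪∅⁻ α (⊆H below ∅ γ hγ))
      β₀≺β (height∈H below d₀)
      (λ sγ → collapse-∷ d₀ sγ α Xs Γ′ below wα hα bound cover ctl)
  collapse d@(cut ψ _ sψ rk≺ β₀≺β d₁ d₂) α Xs Γ′ below wα hα bound cover ctl with Ω∈⊎All≢Ω (k ψ)
  ... | inj₂ Ω∉kψ =
    let sψ⁺ , sψ⁻ = ΣΩ-neg ψ sψ Ω∉kψ in
    collapse-cut ψ wα hα (height∈H below d) bound ctl sψ Ω∉kψ (principal∈H below d₁) β₀≺β (height∈H below d₁)
      (collapse-∷ d₁ sψ⁺ α Xs Γ′ below wα hα bound cover ctl)
      (collapse-∷ d₂ sψ⁻ α Xs Γ′ below wα hα bound cover ctl)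
  ... | inj₁ Ω∈kψ with rk≺Ω+1⇒Ω-literal ψ rk≺ Ω∈kψ
  ...   | φ , t , inj₁ refl =
    collapse-Ω-premises φ t d₁ d₂ α Xs Γ′ below wα hα (height∈H below d) β₀≺β bound cover ctl
  ...   | φ , t , inj₂ refl =
    collapse-Ω-premises φ t d₂ d₁ α Xs Γ′ below wα hα (height∈H below d) β₀≺β bound cover ctl
  collapse d@(fix {φ = φ} {t = t} _ _ m β₀≺β d₀) α Xs Γ′ below wα hα bound cover ctl with cover m
  ... | present m′ _ =
    collapse-fix φ t wα hα (height∈H below d) bound ctl m′ β₀≺β (height∈H below d₀)
      (collapse-∷ d₀ (ΣΩ-instOF φ Ω t tt (≼-refl Ω)) α Xs Γ′ below wα hα bound cover ctl)

  collapse-∷ : ∀ {𝓗 β Γ χ} → 𝓗 ⊢[ β , Ω +ᵗ numᵗ 1 ] (χ ∷ Γ) → ΣΩ-Sentence χ → ∀ α Xs Γ′ →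
    Below𝓗 𝓗 α Xs → WF α → H α Xs α → CoeffBound α Xs → Covers α Xs Γ Γ′ → ControlledBy α Xs Γ′ →
    H[ α +ω β , Xs ] ⊢[ ϑ (α +ω β) , ϑ (α +ω β) ] (χ ∷ Γ′)
  collapse-∷ {χ = χ} d sχ α Xs Γ′ below wα hα bound cover ctl =
    collapse d α Xs (χ ∷ Γ′) below wα hα bound
      (Covers-∷ (λ h → h) cover (present (here refl) sχ))
      (ControlledBy-∷ (λ h → h) ctl (principal∈H below d))

  collapse-Ω-premises : ∀ {𝓗 β β₀ Γ} φ t →
    𝓗 ⊢[ β₀ , Ω +ᵗ numᵗ 1 ] (I Ω φ t ∷ Γ) → 𝓗 ⊢[ β₀ , Ω +ᵗ numᵗ 1 ] (¬I Ω φ t ∷ Γ) → ∀ α Xs Γ′ →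
    Below𝓗 𝓗 α Xs → WF α → H α Xs α → H α Xs β → β₀ ≺ β → CoeffBound α Xs →
    Covers α Xs Γ Γ′ → ControlledBy α Xs Γ′ →
    H[ α +ω β , Xs ] ⊢[ ϑ (α +ω β) , ϑ (α +ω β) ] Γ′
  collapse-Ω-premises {β₀ = β₀} φ t d₁ d₂ α Xs Γ′ below wα hα hβ β₀≺β bound cover ctl =
    collapse-Ω-cut φ t wα hα hβ bound ctl β₀≺β hβ₀
      (collapse-∷ d₁ ((tt , ≼-refl Ω) ∷ [] , tt) α Xs Γ′ below wα hα bound cover ctl)
      (collapse d₂ η₀ Xs (¬I (ϑ η₀) φ t ∷ Γ′) (Below𝓗-monoˡ α≼η₀ below) (WF-+ω α β₀ wα (proj₁ hβ₀))
         (H-monoˡ α η₀ α≼η₀ (H-+ω α α β₀ hα hβ₀)) (CoeffBound-monoˡ α≼η₀ bound)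
         (Covers-∷ (H-monoˡ α η₀ α≼η₀) cover (lowered (here refl) tt hϑη₀))
         (ControlledBy-∷ (H-monoˡ α η₀ α≼η₀) ctl (hϑη₀ ∷ [])))
    where
    hβ₀ : H α Xs β₀
    hβ₀ = height∈H below d₁
    η₀ : Tm
    η₀ = α +ω β₀
    α≼η₀ : α ≼ η₀
    α≼η₀ = ≺⇒≼ α η₀ (+ω-increasing α β₀)
    hϑη₀ : H η₀ Xs (ϑ η₀)
    hϑη₀ = H-ϑ+ω η₀ hα hβ₀ (≼-refl η₀)

theorem6p7 : (Γ : List Sentence) (α β : Tm) (X : Pred) →
    ΣΩ-Sequent Γ →
    WF α →
    X ⊆ WF →
    H α X α →
    (∀ ξ → WF ξ → α ≺ ξ → X ⊆ C ξ (ϑ ξ)) →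
    H[ α , X ] ⊢[ β , Ω +ᵗ numᵗ 1 ] Γ →
    let η = α +ᵗ ωf β in
    H[ η , X ] ⊢[ ϑ η , ϑ η ] Γ
theorem6p7 Γ α β Xs ΣΩ-Γ wα _ hα Xs⊆Cϑ d =
  subst (λ η → H[ η , Xs ] ⊢[ ϑ η , ϑ η ] Γ) (sym (+ᵗωf≡+ω α β))
    (collapse d α Xs Γ (below𝓗 λ _ _ h → h) wα hα (coeffBound Xs⊆Cϑ)
       (λ m → present m (lookup ΣΩ-Γ m))
       (controlledBy λ m → All-map (H-∪∅⁻ α) (proj₂ (side d) m)))
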